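{- Let $X$ be a finite set of variables and $Z_1,P_1,Z_2,P_2\subseteq\mathbb{Q}[X]$ finite sets of polynomials. Then \[ \mathrm{alg.cone}_X(\mathit{intersect}(Z_1,P_1,Z_2,P_2)) = \mathrm{alg.cone}_X(Z_1,P_1)\cap\mathrm{alg.cone}_X(Z_2,P_2). \]
   Context: For finite $Z,P \subseteq \mathbb{Q}[V]$, $\mathrm{alg.cone}_V(Z,P) = \langle Z\rangle_V + \mathrm{cone}(P)$ ($\langle Z\rangle_V$ the ideal of $\mathbb{Q}[V]$ generated by $Z$; $\mathrm{cone}(P)$ the non-negative rational combinations of $P$). Let $t \notin X$ be a fresh variable and for a polynomial $f$ and set $S$ write $fS = \{fs : s\in S\}$. Define $\mathit{intersect}(Z_1,P_1,Z_2,P_2) = \mathit{project}_X(tZ_1\cup(1-t)Z_2,\ tP_1\cup(1-t)P_2)$, computed in $\mathbb{Q}[X\cup\{t\}]$. Here, for $X\subseteq Y$ and finite $Z,P\subseteq\mathbb{Q}[Y]$: fix a monomial ordering $\preceq$; the elimination ordering $\preceq_X$ compares monomials $m=m_Xm_{\overline X}$, $n=n_Xn_{\overline X}$ (factored into parts over $X$ and over $Y\setminus X$) by $m\preceq_X n$ iff $m_{\overline X}\prec n_{\overline X}$, or $m_{\overline X}=n_{\overline X}$ and $m_X\preceq n_X$; $\mathit{project}_X(Z,P) = \langle G\cap\mathbb{Q}[X],\ \mathrm{proj}(\{\mathbf{red}_G(p):p\in P\},[X])\rangle$ where $G$ is a Gröbner basis of the ideal generated by $Z$ in $\mathbb{Q}[Y]$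 w.r.t. $\preceq_X$, $\mathbf{red}_G$ is normal form modulo $G$, $[X]$ is the set of monomials over $X$, and $\mathrm{proj}(S,N)$ is a finite set with $\mathrm{cone}(\mathrm{proj}(S,N))=\mathrm{cone}(S)\cap\mathrm{span}_{\mathbb{Q}}(N)$. -}

module Defs where

open import Data.Nat as ℕ using (ℕ; zero; suc)
open import Data.Rational as ℚ using (ℚ; 0ℚ; 1ℚ)
open import Data.Vec as Vec using (Vec; _++_; take; drop; replicate; zipWith; lookup)
open import Data.Vec.Properties using (≡-dec)
open import Data.Fin using (Fin)
open import Data.List as List using (List; []; _∷_; map; concatMap; foldr)
open import Data.List.Membership.Propositional using (_∈_)
open import Data.List.Relation.Unary.All using (All)
open import Data.Product using (Σ; Σ-syntax; ∃; _×_; _,_)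
open import Data.Sum using (_⊎_)
open import Relation.Binary.PropositionalEquality using (_≡_; _≢_)
open import Relation.Binary.Structures using (IsTotalOrder)
open import Relation.Nullary using (yes; no; ¬_)
open import Relation.Unary using (Pred)
open import Induction.WellFounded using (WellFounded)
open import Level using (0ℓ)

Mono : ℕ → Set
Mono k = Vec ℕ k

oneM : ∀ {k} → Mono k
oneM = replicate _ 0

_·m_ : ∀ {k} → Mono k → Mono k → Mono k
_·m_ = zipWith ℕ._+_

_∣m_ : ∀ {k} → Mono k → Mono k → Set
a ∣m b = ∀ i → lookup a i ℕ.≤ lookup b i

-- Polynomials in ℚ[x_0..x_{k-1}]: finite formal sums of terms c·m.
-- Equality is semantic (equal coefficient functions).

Poly : ℕ → Set
Poly k = List (ℚ × Mono k)

coeff : ∀ {k} → Poly k → Mono k → ℚ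
coeff [] m = 0ℚ
coeff ((c , m') ∷ p) m with ≡-dec ℕ._≟_ m' m
... | yes _ = c ℚ.+ coeff p m
... | no _  = coeff p m

_≈_ : ∀ {k} → Poly k → Poly k → Set
p ≈ q = ∀ m → coeff p m ≡ coeff q m

0P : ∀ {k} → Poly k
0P = []

1P : ∀ {k} → Poly k
1P = (1ℚ , oneM) ∷ []

_+P_ : ∀ {k} → Poly k → Poly k → Poly k
p +P q = p List.++ q

scale : ∀ {k} → ℚ → Poly k → Poly k
scale c = map (λ { (d , m) → (c ℚ.* d , m) })

-P_ : ∀ {k} → Poly k → Poly k
-P p = scale (ℚ.- 1ℚ) p

_-P_ : ∀ {k} → Poly k → Poly k → Poly k
p -P q = p +P (-P q)

_*P_ : ∀ {k} → Poly k → Poly k → Poly k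
p *P q = concatMap (λ { (c , m) → map (λ { (d , m') → (c ℚ.* d , m ·m m') }) q }) p

sumP : ∀ {k} → List (Poly k) → Poly k
sumP = foldr _+P_ 0P

InIdeal : ∀ {k} → Pred (Poly k) 0ℓ → Poly k → Set
InIdeal {k} S f =
  Σ[ hs ∈ List (Poly k × Poly k) ]
    All (λ { (h , z) → S z }) hs × f ≈ sumP (map (λ { (h , z) → h *P z }) hs)

InCone : ∀ {k} → List (Poly k) → Poly k → Set
InCone {k} P f =
  Σ[ cs ∈ List (ℚ × Poly k) ]
    All (λ { (c , p) → (0ℚ ℚ.≤ c) × p ∈ P }) cs × f ≈ sumP (map (λ { (c , p) → scale c p }) cs)

InAlgCone : ∀ {k} → Pred (Poly k) 0ℓ → List (Poly k) → Poly k → Set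
InAlgCone S P f = Σ[ a ∈ _ ] Σ[ b ∈ _ ] InIdeal S a × InCone P b × f ≈ (a +P b)

⟦_⟧ : ∀ {k} → List (Poly k) → Pred (Poly k) 0ℓ
⟦ Z ⟧ z = z ∈ Z

record MonomialOrder (k : ℕ) : Set₁ where
  field
    _⪯_ : Mono k → Mono k → Set
    isTotalOrder : IsTotalOrder _≡_ _⪯_
    multiplicative : ∀ a b c → a ⪯ b → (a ·m c) ⪯ (b ·m c)
    wellOrder : WellFounded (λ a b → a ⪯ b × a ≢ b)

  _≺_ : Mono k → Mono k → Set
  a ≺ b = a ⪯ b × a ≢ b

-- Variables Y = X ⊎ X̄ where X = first n variables, X̄ = last m variables.
partX : ∀ {n m} → Mono (n ℕ.+ m) → Mono (n ℕ.+ m)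
partX {n} {m} a = take n a ++ replicate m 0

partX̄ : ∀ {n m} → Mono (n ℕ.+ m) → Mono (n ℕ.+ m)
partX̄ {n} {m} a = replicate n 0 ++ drop n a

elimOrder : ∀ {n m} → MonomialOrder (n ℕ.+ m) → Mono (n ℕ.+ m) → Mono (n ℕ.+ m) → Set
elimOrder {n} {m} ord a b =
  (partX̄ {n} {m} a ≺ partX̄ {n} {m} b) ⊎ (partX̄ {n} {m} a ≡ partX̄ {n} {m} b × partX {n} {m} a ⪯ partX {n} {m} b)
  where open MonomialOrder ord

module _ {k : ℕ} (_≤_ : Mono k → Mono k → Set) where

  IsLM : Poly k → Mono k → Set
  IsLM p m = (coeff p m ≢ 0ℚ) × (∀ m' → coeff p m' ≢ 0ℚ → m' ≤ m)

  -- G is a Gröbner basis of the ideal ⟨Z⟩: G ⊆ ⟨Z⟩ and ⟨LM(G)⟩ = ⟨LM(⟨Z⟩)⟩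
  IsGroebnerBasis : List (Poly k) → List (Poly k) → Set
  IsGroebnerBasis G Z =
    All (InIdeal ⟦ Z ⟧) G ×
    (∀ f mf → InIdeal ⟦ Z ⟧ f → IsLM f mf →
       Σ[ g ∈ Poly k ] Σ[ mg ∈ Mono k ] g ∈ G × IsLM g mg × mg ∣m mf)

  IsNormalForm : List (Poly k) → Poly k → Poly k → Set
  IsNormalForm G p r =
    InIdeal ⟦ G ⟧ (p -P r) ×
    (∀ g mg m → g ∈ G → IsLM g mg → coeff r m ≢ 0ℚ → ¬ (mg ∣m m))

embed : ∀ {n} m → Poly n → Poly (n ℕ.+ m)
embed m = map (λ { (c , a) → (c , a ++ replicate m 0) })

InSpanX : ∀ {n m} → Poly (n ℕ.+ m) → Set
InSpanX {n} {m} f = ∀ a → coeff f a ≢ 0ℚ → drop n a ≡ replicate m 0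

GInX : ∀ {n m} → List (Poly (n ℕ.+ m)) → Pred (Poly n) 0ℓ
GInX {n} {m} G h = Σ[ g ∈ Poly (n ℕ.+ m) ] g ∈ G × embed m h ≈ g

IsProjX : ∀ {n m} → List (Poly (n ℕ.+ m)) → List (Poly n) → Set
IsProjX {n} {m} S Q =
  ∀ f → (InCone (map (embed m) Q) f → InCone S f × InSpanX {n} {m} f)
      × (InCone S f × InSpanX {n} {m} f → InCone (map (embed m) Q) f)

-- The data of intersect(Z1,P1,Z2,P2) in ℚ[X ∪ {t}], t the last variable.

tVar : ∀ {n} → Poly (n ℕ.+ 1)
tVar {n} = (1ℚ , replicate n 0 ++ (1 Vec.∷ Vec.[])) ∷ []

interZ : ∀ {n} → List (Poly n) → List (Poly n) → List (Poly (n ℕ.+ 1))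
interZ {n} Z₁ Z₂ = map (λ z → tVar *P embed 1 z) Z₁ List.++ map (λ z → (1P -P tVar) *P embed 1 z) Z₂

interP : ∀ {n} → List (Poly n) → List (Poly n) → List (Poly (n ℕ.+ 1))
interP = interZ

{-# OPTIONS --safe #-}
module Submission where

-- Evaluating t at 1 and at 0 gives ring maps ℚ[X,t] → ℚ[X] fixing ℚ[X].  The first maps
-- tZ₁ ∪ (1-t)Z₂ into ⟨Z₁⟩ and tP₁ ∪ (1-t)P₂ into alg.cone(Z₁,P₁), the second does the same for
-- Z₂, P₂.  As G lies in ⟨tZ₁ ∪ (1-t)Z₂⟩ and every element of R differs from the corresponding
-- element of tP₁ ∪ (1-t)P₂ by an element of ⟨G⟩, this gives ⊆.
--
-- Conversely, if f lies in both algebraic cones, then f = t·f + (1-t)·f lies in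
-- alg.cone(tZ₁ ∪ (1-t)Z₂, R), say f = h + c.  Both h and c lie in ℚ[X]: otherwise the leading
-- monomial of h for the elimination ordering involves t, so it occurs in some r ∈ R and is
-- divisible by a leading monomial of G, which is impossible for a normal form.  Hence c ∈ cone(Q)
-- by the defining property of Q, and h ∈ ⟨G ∩ ℚ[X]⟩ by the division algorithm: an element of G
-- whose leading monomial lies in ℚ[X] lies itself in ℚ[X].

open import Defs
open import Data.Nat using (ℕ; _+_)
open import Data.List using (List)
open import Data.Product using (_×_)
open import Data.List.Relation.Binary.Pointwise using (Pointwise)
open import Function.Bundles using (_⇔_)

open import Algebra.Bundles using (CommutativeRing)
open import Data.Empty using (⊥; ⊥-elim)
import Data.Fin as Fin
open import Data.List as List using ([]; _∷_; map; length)
open import Data.List.Membership.Propositional using (_∈_; find; lose)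
open import Data.List.Membership.Propositional.Properties
  using (∉[]; ∈-map⁺; ∈-map⁻; ∈-++⁺ˡ; ∈-++⁺ʳ; ∈-++⁻; ∈-filter⁺; ∈-filter⁻)
import Data.List.Properties as List
import Data.List.Relation.Binary.Pointwise as PW
open import Data.List.Relation.Unary.All as All using (All)
open import Data.List.Relation.Unary.All.Properties using (++⁺)
open import Data.List.Relation.Unary.Any using (here; there; any?)
open import Data.Nat as ℕ using (zero; suc)
import Data.Nat.Properties as ℕ
open import Data.Product using (Σ-syntax; _,_; proj₁; proj₂)
open import Data.Rational as ℚ using (ℚ; 0ℚ; 1ℚ)
import Data.Rational.Properties as ℚ
open import Data.Rational.Solver using (module +-*-Solver)
open import Data.Sum using (_⊎_; inj₁; inj₂)
open import Data.Vec as Vec using (Vec)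
open import Data.Vec.Properties
  using ( ≡-dec; ++-injectiveʳ; zipWith-comm; zipWith-assoc; zipWith-identityˡ; zipWith-identityʳ
        ; zipWith-++; take-zipWith; drop-zipWith; take++drop≡id)
open import Function.Bundles using (mk⇔)
open import Induction.WellFounded using (Acc; acc)
open import Level using (0ℓ)
open import Relation.Binary.Bundles using (Setoid)
import Relation.Binary.PropositionalEquality as ≡
open import Relation.Binary.PropositionalEquality
  using (_≡_; _≢_; refl; sym; trans; cong; cong₂; subst; subst₂; module ≡-Reasoning)
import Relation.Binary.Reasoning.Setoid as SetoidReasoning
open import Relation.Binary.Structures using (IsTotalPreorder; IsTotalOrder)
open import Relation.Nullary using (¬_; ¬?; yes; no)
open import Relation.Nullary.Decidable using (decidable-stable)
open import Relation.Unary using (Pred)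

open import Algebra.Properties.Group ℚ.+-0-group using (x∙y⁻¹≈ε⇒x≈y)
open import Algebra.Properties.Semiring.Exp (CommutativeRing.semiring ℚ.+-*-commutativeRing) using (_^_; ^-homo-*)

open +-*-Solver using (solve; _:+_; _:*_; :-_; _:=_; con)

private
  variable
    k : ℕ

Pointwise-∈ˡ : ∀ {A B : Set} {_∼_ : A → B → Set} {xs ys} → Pointwise _∼_ xs ys →
               ∀ {x} → x ∈ xs → Σ[ y ∈ B ] y ∈ ys × x ∼ y
Pointwise-∈ˡ (x∼y PW.∷ _)  (here refl) = _ , here refl , x∼y
Pointwise-∈ˡ (_   PW.∷ xs∼ys) (there x∈) with Pointwise-∈ˡ xs∼ys x∈
... | y , y∈ , x∼y = y , there y∈ , x∼y

Pointwise-∈ʳ : ∀ {A B : Set} {_∼_ : A → B → Set} {xs ys} → Pointwise _∼_ xs ys →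
               ∀ {y} → y ∈ ys → Σ[ x ∈ A ] x ∈ xs × x ∼ y
Pointwise-∈ʳ (x∼y PW.∷ _)  (here refl) = _ , here refl , x∼y
Pointwise-∈ʳ (_   PW.∷ xs∼ys) (there y∈) with Pointwise-∈ʳ xs∼ys y∈
... | x , x∈ , x∼y = x , there x∈ , x∼y

δ : Mono k → Mono k → ℚ
δ m a with ≡-dec ℕ._≟_ a m
... | yes _ = 1ℚ
... | no  _ = 0ℚ

δ-≢ : (m a : Mono k) → a ≢ m → δ m a ≡ 0ℚ
δ-≢ m a a≢m with ≡-dec ℕ._≟_ a m
... | yes a≡m = ⊥-elim (a≢m a≡m)
... | no  _   = refl

-- Polynomials are only ever compared through the linear functionals lin F;
-- coefficients are the special case F = δ m.
lin : (Mono k → ℚ) → Poly k → ℚ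
lin F []            = 0ℚ
lin F ((c , a) ∷ p) = c ℚ.* F a ℚ.+ lin F p

coeff≡lin : ∀ (p : Poly k) m → coeff p m ≡ lin (δ m) p
coeff≡lin []            m = refl
coeff≡lin ((c , a) ∷ p) m with ≡-dec ℕ._≟_ a m
... | yes _ = cong₂ ℚ._+_ (sym (ℚ.*-identityʳ c)) (coeff≡lin p m)
... | no  _ = trans (coeff≡lin p m) (sym (trans (cong (ℚ._+ lin (δ m) p) (ℚ.*-zeroʳ c)) (ℚ.+-identityˡ _)))

lin-+P : ∀ F (p q : Poly k) → lin F (p +P q) ≡ lin F p ℚ.+ lin F q
lin-+P F []            q = sym (ℚ.+-identityˡ _)
lin-+P F ((c , a) ∷ p) q =
  trans (cong (c ℚ.* F a ℚ.+_) (lin-+P F p q)) (sym (ℚ.+-assoc (c ℚ.* F a) (lin F p) (lin F q)))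

lin-scale : ∀ F d (p : Poly k) → lin F (scale d p) ≡ d ℚ.* lin F p
lin-scale F d []            = sym (ℚ.*-zeroʳ d)
lin-scale F d ((c , a) ∷ p) =
  trans (cong₂ ℚ._+_ (ℚ.*-assoc d c (F a)) (lin-scale F d p)) (sym (ℚ.*-distribˡ-+ d _ _))

lin-+ᶠ : ∀ F G (p : Poly k) → lin (λ a → F a ℚ.+ G a) p ≡ lin F p ℚ.+ lin G p
lin-+ᶠ F G []            = sym (ℚ.+-identityˡ _)
lin-+ᶠ F G ((c , a) ∷ p) rewrite lin-+ᶠ F G p =
  solve 5 (λ c x y u v → c :* (x :+ y) :+ (u :+ v) := c :* x :+ u :+ (c :* y :+ v)) refl
        c (F a) (G a) (lin F p) (lin G p)

lin-*ᶠ : ∀ d F (p : Poly k) → lin (λ a → d ℚ.* F a) p ≡ d ℚ.* lin F p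
lin-*ᶠ d F []            = sym (ℚ.*-zeroʳ d)
lin-*ᶠ d F ((c , a) ∷ p) rewrite lin-*ᶠ d F p =
  solve 4 (λ d c x u → c :* (d :* x) :+ d :* u := d :* (c :* x :+ u)) refl d c (F a) (lin F p)

lin-0ᶠ : ∀ (p : Poly k) → lin (λ _ → 0ℚ) p ≡ 0ℚ
lin-0ᶠ []            = refl
lin-0ᶠ ((c , a) ∷ p) rewrite lin-0ᶠ p | ℚ.*-zeroʳ c = refl

lin-congᶠ : ∀ {F G : Mono k → ℚ} (p : Poly k) → (∀ a → F a ≡ G a) → lin F p ≡ lin G p
lin-congᶠ []            F≗G = refl
lin-congᶠ ((c , a) ∷ p) F≗G = cong₂ (λ x y → c ℚ.* x ℚ.+ y) (F≗G a) (lin-congᶠ p F≗G)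

coeff-+P : ∀ (p q : Poly k) m → coeff (p +P q) m ≡ coeff p m ℚ.+ coeff q m
coeff-+P p q m = begin
  coeff (p +P q) m                    ≡⟨ coeff≡lin (p +P q) m ⟩
  lin (δ m) (p +P q)                  ≡⟨ lin-+P (δ m) p q ⟩
  lin (δ m) p ℚ.+ lin (δ m) q         ≡⟨ sym (cong₂ ℚ._+_ (coeff≡lin p m) (coeff≡lin q m)) ⟩
  coeff p m ℚ.+ coeff q m             ∎
  where open ≡-Reasoning

coeff-scale : ∀ d (p : Poly k) m → coeff (scale d p) m ≡ d ℚ.* coeff p m
coeff-scale d p m = begin
  coeff (scale d p) m     ≡⟨ coeff≡lin (scale d p) m ⟩
  lin (δ m) (scale d p)   ≡⟨ lin-scale (δ m) d p ⟩
  d ℚ.* lin (δ m) p       ≡⟨ cong (d ℚ.*_) (sym (coeff≡lin p m)) ⟩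
  d ℚ.* coeff p m         ∎
  where open ≡-Reasoning

-1*x≡-x : ∀ x → ℚ.- 1ℚ ℚ.* x ≡ ℚ.- x
-1*x≡-x = solve 1 (λ x → :- con 1ℚ :* x := :- x) refl

coeff--P : ∀ (p q : Poly k) m → coeff (p -P q) m ≡ coeff p m ℚ.- coeff q m
coeff--P p q m =
  trans (coeff-+P p _ m) (cong (coeff p m ℚ.+_) (trans (coeff-scale (ℚ.- 1ℚ) q m) (-1*x≡-x (coeff q m))))

-- lin-congˢ is proved by induction on the length, which deleting a monomial decreases.
remove : Mono k → Poly k → Poly k
remove a []            = []
remove a ((c , b) ∷ p) with ≡-dec ℕ._≟_ b a
... | yes _ = remove a p
... | no  _ = (c , b) ∷ remove a p

length-remove : ∀ a (p : Poly k) → length (remove a p) ℕ.≤ length p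
length-remove a []            = ℕ.z≤n
length-remove a ((c , b) ∷ p) with ≡-dec ℕ._≟_ b a
... | yes _ = ℕ.m≤n⇒m≤1+n (length-remove a p)
... | no  _ = ℕ.s≤s (length-remove a p)

lin-remove : ∀ F a (p : Poly k) → lin F p ≡ coeff p a ℚ.* F a ℚ.+ lin F (remove a p)
lin-remove F a []            = sym (trans (cong (ℚ._+ 0ℚ) (ℚ.*-zeroˡ (F a))) (ℚ.+-identityʳ 0ℚ))
lin-remove F a ((c , b) ∷ p) with ≡-dec ℕ._≟_ b a
... | yes refl rewrite lin-remove F b p =
  solve 4 (λ c x y u → c :* x :+ (y :* x :+ u) := (c :+ y) :* x :+ u) refl
        c (F b) (coeff p b) (lin F (remove b p))
... | no  _ rewrite lin-remove F a p =
  solve 5 (λ c z x y u → c :* z :+ (y :* x :+ u) := y :* x :+ (c :* z :+ u)) refl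
        c (F b) (F a) (coeff p a) (lin F (remove a p))

coeff-remove-same : ∀ a (p : Poly k) → coeff (remove a p) a ≡ 0ℚ
coeff-remove-same a []            = refl
coeff-remove-same a ((c , b) ∷ p) with ≡-dec ℕ._≟_ b a
... | yes _ = coeff-remove-same a p
... | no b≢a with ≡-dec ℕ._≟_ b a
...   | yes b≡a = ⊥-elim (b≢a b≡a)
...   | no  _   = coeff-remove-same a p

coeff-remove-other : ∀ a (p : Poly k) m → a ≢ m → coeff (remove a p) m ≡ coeff p m
coeff-remove-other a []            m a≢m = refl
coeff-remove-other a ((c , b) ∷ p) m a≢m with ≡-dec ℕ._≟_ b a
... | yes refl with ≡-dec ℕ._≟_ b m
...   | yes b≡m = ⊥-elim (a≢m b≡m)
...   | no  _   = coeff-remove-other b p m a≢m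
coeff-remove-other a ((c , b) ∷ p) m a≢m | no _ with ≡-dec ℕ._≟_ b m
...   | yes _ = cong (c ℚ.+_) (coeff-remove-other a p m a≢m)
...   | no  _ = coeff-remove-other a p m a≢m

coeff-remove-zero : ∀ a (p : Poly k) m → coeff p m ≡ 0ℚ → coeff (remove a p) m ≡ 0ℚ
coeff-remove-zero a p m p₀ with ≡-dec ℕ._≟_ a m
... | yes refl = coeff-remove-same a p
... | no  a≢m  = trans (coeff-remove-other a p m a≢m) p₀

lin-congˢ : ∀ (p : Poly k) {F G : Mono k → ℚ} → (∀ a → coeff p a ≢ 0ℚ → F a ≡ G a) → lin F p ≡ lin G p
lin-congˢ p = bounded (length p) p ℕ.≤-refl
  where
  bounded : ∀ N (p : Poly k) {F G : Mono k → ℚ} → length p ℕ.≤ N →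
            (∀ a → coeff p a ≢ 0ℚ → F a ≡ G a) → lin F p ≡ lin G p
  bounded N       []              _            _   = refl
  bounded (suc N) p@((c , a) ∷ q) {F} {G} (ℕ.s≤s |q|≤N) F≗G = begin
    lin F p                                    ≡⟨ lin-remove F a p ⟩
    coeff p a ℚ.* F a ℚ.+ lin F (remove a p)   ≡⟨ cong₂ ℚ._+_ at-a (bounded N (remove a p) shorter off-a) ⟩
    coeff p a ℚ.* G a ℚ.+ lin G (remove a p)   ≡⟨ sym (lin-remove G a p) ⟩
    lin G p                                    ∎
    where
    open ≡-Reasoning
    at-a : coeff p a ℚ.* F a ≡ coeff p a ℚ.* G a
    at-a with coeff p a ℚ.≟ 0ℚ
    ... | yes p₀ rewrite p₀ = trans (ℚ.*-zeroˡ (F a)) (sym (ℚ.*-zeroˡ (G a)))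
    ... | no  p≢0 = cong (coeff p a ℚ.*_) (F≗G a p≢0)
    shorter : length (remove a p) ℕ.≤ N
    shorter with ≡-dec ℕ._≟_ a a
    ... | yes _  = ℕ.≤-trans (length-remove a q) |q|≤N
    ... | no a≢a = ⊥-elim (a≢a refl)
    off-a : ∀ b → coeff (remove a p) b ≢ 0ℚ → F b ≡ G b
    off-a b nz = F≗G b (λ p₀ → nz (coeff-remove-zero a p b p₀))

lin-resp-≈ : ∀ F {p q : Poly k} → p ≈ q → lin F p ≡ lin F q
lin-resp-≈ F {p} {q} p≈q = x∙y⁻¹≈ε⇒x≈y _ _ (begin
  lin F p ℚ.- lin F q            ≡⟨ sym lin-difference ⟩
  lin F (p -P q)                 ≡⟨ lin-congˢ (p -P q) (λ a nz → ⊥-elim (nz (difference-vanishes a))) ⟩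
  lin (λ _ → 0ℚ) (p -P q)        ≡⟨ lin-0ᶠ (p -P q) ⟩
  0ℚ                             ∎)
  where
  open ≡-Reasoning
  lin-difference : lin F (p -P q) ≡ lin F p ℚ.- lin F q
  lin-difference = trans (lin-+P F p _) (cong (lin F p ℚ.+_) (trans (lin-scale F (ℚ.- 1ℚ) q) (-1*x≡-x (lin F q))))
  difference-vanishes : ∀ a → coeff (p -P q) a ≡ 0ℚ
  difference-vanishes a = trans (coeff--P p q a) (trans (cong (λ x → coeff p a ℚ.- x) (sym (p≈q a))) (ℚ.+-inverseʳ (coeff p a)))

-- A record wrapper around _≈_, whose sides Agda can then infer.
infix 4 _≋_
record _≋_ (p q : Poly k) : Set where
  constructor mk≋
  field ≋⇒≈ : p ≈ q
open _≋_ public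

≋-refl : {p : Poly k} → p ≋ p
≋-refl = mk≋ (λ _ → refl)

≋-sym : {p q : Poly k} → p ≋ q → q ≋ p
≋-sym (mk≋ e) = mk≋ (λ m → sym (e m))

≋-trans : {p q r : Poly k} → p ≋ q → q ≋ r → p ≋ r
≋-trans (mk≋ e) (mk≋ f) = mk≋ (λ m → trans (e m) (f m))

≡⇒≋ : {p q : Poly k} → p ≡ q → p ≋ q
≡⇒≋ refl = ≋-refl

≋-setoid : ℕ → Setoid 0ℓ 0ℓ
≋-setoid k = record
  { Carrier = Poly k ; _≈_ = _≋_
  ; isEquivalence = record { refl = ≋-refl ; sym = ≋-sym ; trans = ≋-trans } }

module ≋-Reasoning {k : ℕ} = SetoidReasoning (≋-setoid k)

lin-resp-≋ : ∀ F {p q : Poly k} → p ≋ q → lin F p ≡ lin F q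
lin-resp-≋ F {p} {q} (mk≋ e) = lin-resp-≈ F {p} {q} e

≋-by-lin : {p q : Poly k} → (∀ m → lin (δ m) p ≡ lin (δ m) q) → p ≋ q
≋-by-lin {p = p} {q} h = mk≋ (λ m → trans (coeff≡lin p m) (trans (h m) (sym (coeff≡lin q m))))

·m-comm : (a b : Mono k) → a ·m b ≡ b ·m a
·m-comm = zipWith-comm ℕ.+-comm

·m-assoc : (a b c : Mono k) → (a ·m b) ·m c ≡ a ·m (b ·m c)
·m-assoc = zipWith-assoc ℕ.+-assoc

·m-identityˡ : (a : Mono k) → oneM ·m a ≡ a
·m-identityˡ = zipWith-identityˡ ℕ.+-identityˡ

·m-identityʳ : (a : Mono k) → a ·m oneM ≡ a
·m-identityʳ = zipWith-identityʳ ℕ.+-identityʳ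

·m-cancelˡ : (x a b : Mono k) → x ·m a ≡ x ·m b → a ≡ b
·m-cancelˡ Vec.[]       Vec.[]       Vec.[]       _ = refl
·m-cancelˡ (y Vec.∷ x) (u Vec.∷ a) (v Vec.∷ b) e =
  cong₂ Vec._∷_ (ℕ.+-cancelˡ-≡ y u v (cong Vec.head e)) (·m-cancelˡ x a b (cong Vec.tail e))

δ-·m : (x a b : Mono k) → δ (x ·m a) (x ·m b) ≡ δ a b
δ-·m x a b with ≡-dec ℕ._≟_ (x ·m b) (x ·m a) | ≡-dec ℕ._≟_ b a
... | yes _   | yes _   = refl
... | no  _   | no  _   = refl
... | yes e   | no  b≢a = ⊥-elim (b≢a (·m-cancelˡ x b a e))
... | no  x≢x | yes refl = ⊥-elim (x≢x refl)

lin-*P : ∀ F (p q : Poly k) → lin F (p *P q) ≡ lin (λ a → lin (λ b → F (a ·m b)) q) p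
lin-*P F []            q = refl
lin-*P F ((c , a) ∷ p) q =
  trans (lin-+P F (map (λ { (d , b) → (c ℚ.* d , a ·m b) }) q) (p *P q))
        (cong₂ ℚ._+_ (row q) (lin-*P F p q))
  where
  row : ∀ q → lin F (map (λ { (d , b) → (c ℚ.* d , a ·m b) }) q) ≡ c ℚ.* lin (λ b → F (a ·m b)) q
  row []            = sym (ℚ.*-zeroʳ c)
  row ((d , b) ∷ q) = trans (cong (c ℚ.* d ℚ.* F (a ·m b) ℚ.+_) (row q))
    (solve 4 (λ c d x u → c :* d :* x :+ c :* u := c :* (d :* x :+ u)) refl c d (F (a ·m b)) (lin (λ b → F (a ·m b)) q))

lin-swap : ∀ (H : Mono k → Mono k → ℚ) (p q : Poly k) →
           lin (λ a → lin (H a) q) p ≡ lin (λ b → lin (λ a → H a b) p) q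
lin-swap H []            q = sym (lin-0ᶠ q)
lin-swap H ((c , a) ∷ p) q = begin
  c ℚ.* lin (H a) q ℚ.+ lin (λ a → lin (H a) q) p                   ≡⟨ cong (c ℚ.* lin (H a) q ℚ.+_) (lin-swap H p q) ⟩
  c ℚ.* lin (H a) q ℚ.+ lin (λ b → lin (λ a → H a b) p) q           ≡⟨ cong (ℚ._+ _) (sym (lin-*ᶠ c (H a) q)) ⟩
  lin (λ b → c ℚ.* H a b) q ℚ.+ lin (λ b → lin (λ a → H a b) p) q   ≡⟨ sym (lin-+ᶠ _ _ q) ⟩
  lin (λ b → c ℚ.* H a b ℚ.+ lin (λ a → H a b) p) q                 ∎
  where open ≡-Reasoning

+P-cong : {p p′ q q′ : Poly k} → p ≋ p′ → q ≋ q′ → p +P q ≋ p′ +P q′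
+P-cong {p = p} {p′} {q} {q′} (mk≋ e) (mk≋ f) =
  mk≋ (λ m → trans (coeff-+P p q m) (trans (cong₂ ℚ._+_ (e m) (f m)) (sym (coeff-+P p′ q′ m))))

+P-identityʳ : (p : Poly k) → p +P 0P ≋ p
+P-identityʳ p = ≡⇒≋ (List.++-identityʳ p)

scale-cong : ∀ c {p p′ : Poly k} → p ≋ p′ → scale c p ≋ scale c p′
scale-cong c {p} {p′} (mk≋ e) =
  mk≋ (λ m → trans (coeff-scale c p m) (trans (cong (c ℚ.*_) (e m)) (sym (coeff-scale c p′ m))))

scale-+P : ∀ c (p q : Poly k) → scale c (p +P q) ≡ scale c p +P scale c q
scale-+P c p q = List.map-++ _ p q

scale-scale : ∀ c d (p : Poly k) → scale c (scale d p) ≋ scale (c ℚ.* d) p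
scale-scale c d p = mk≋ (λ m → trans (coeff-scale c (scale d p) m) (trans (cong (c ℚ.*_) (coeff-scale d p m))
  (trans (sym (ℚ.*-assoc c d _)) (sym (coeff-scale (c ℚ.* d) p m)))))

scale-identity : (p : Poly k) → scale 1ℚ p ≋ p
scale-identity p = mk≋ (λ m → trans (coeff-scale 1ℚ p m) (ℚ.*-identityˡ _))

scale-zero : (p : Poly k) → scale 0ℚ p ≋ 0P
scale-zero p = mk≋ (λ m → trans (coeff-scale 0ℚ p m) (ℚ.*-zeroˡ (coeff p m)))

*P-congˡ : {p p′ : Poly k} (q : Poly k) → p ≋ p′ → p *P q ≋ p′ *P q
*P-congˡ {p = p} {p′} q e = ≋-by-lin λ m →
  trans (lin-*P (δ m) p q) (trans (lin-resp-≋ _ e) (sym (lin-*P (δ m) p′ q)))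

*P-congʳ : (p : Poly k) {q q′ : Poly k} → q ≋ q′ → p *P q ≋ p *P q′
*P-congʳ p {q} {q′} e = ≋-by-lin λ m →
  trans (lin-*P (δ m) p q) (trans (lin-congᶠ p (λ a → lin-resp-≋ _ e)) (sym (lin-*P (δ m) p q′)))

*P-comm : (p q : Poly k) → p *P q ≋ q *P p
*P-comm p q = ≋-by-lin λ m → begin
  lin (δ m) (p *P q)                                 ≡⟨ lin-*P (δ m) p q ⟩
  lin (λ a → lin (λ b → δ m (a ·m b)) q) p           ≡⟨ lin-swap (λ a b → δ m (a ·m b)) p q ⟩
  lin (λ b → lin (λ a → δ m (a ·m b)) p) q           ≡⟨ lin-congᶠ q (λ b → lin-congᶠ p (λ a → cong (δ m) (·m-comm a b))) ⟩
  lin (λ b → lin (λ a → δ m (b ·m a)) p) q           ≡⟨ sym (lin-*P (δ m) q p) ⟩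
  lin (δ m) (q *P p)                                 ∎
  where open ≡-Reasoning

*P-assoc : (p q r : Poly k) → (p *P q) *P r ≋ p *P (q *P r)
*P-assoc p q r = ≋-by-lin λ m → begin
  lin (δ m) ((p *P q) *P r)                                                  ≡⟨ lin-*P (δ m) (p *P q) r ⟩
  lin (λ a → lin (λ c → δ m (a ·m c)) r) (p *P q)                            ≡⟨ lin-*P _ p q ⟩
  lin (λ a → lin (λ b → lin (λ c → δ m ((a ·m b) ·m c)) r) q) p              ≡⟨ lin-congᶠ p (λ a → lin-congᶠ q (λ b →
                                                                                  lin-congᶠ r (λ c → cong (δ m) (·m-assoc a b c)))) ⟩
  lin (λ a → lin (λ b → lin (λ c → δ m (a ·m (b ·m c))) r) q) p              ≡⟨ sym (lin-congᶠ p (λ a → lin-*P _ q r)) ⟩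
  lin (λ a → lin (λ d → δ m (a ·m d)) (q *P r)) p                            ≡⟨ sym (lin-*P (δ m) p (q *P r)) ⟩
  lin (δ m) (p *P (q *P r))                                                  ∎
  where open ≡-Reasoning

*P-distribˡ : (r p q : Poly k) → r *P (p +P q) ≋ (r *P p) +P (r *P q)
*P-distribˡ r p q = ≋-by-lin λ m → begin
  lin (δ m) (r *P (p +P q))                                   ≡⟨ lin-*P (δ m) r (p +P q) ⟩
  lin (λ a → lin (λ b → δ m (a ·m b)) (p +P q)) r             ≡⟨ lin-congᶠ r (λ a → lin-+P _ p q) ⟩
  lin (λ a → lin _ p ℚ.+ lin _ q) r                           ≡⟨ lin-+ᶠ _ _ r ⟩
  lin _ r ℚ.+ lin _ r                                         ≡⟨ sym (cong₂ ℚ._+_ (lin-*P (δ m) r p) (lin-*P (δ m) r q)) ⟩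
  lin (δ m) (r *P p) ℚ.+ lin (δ m) (r *P q)                   ≡⟨ sym (lin-+P (δ m) (r *P p) (r *P q)) ⟩
  lin (δ m) ((r *P p) +P (r *P q))                            ∎
  where open ≡-Reasoning

*P-distribʳ : (p q r : Poly k) → (p +P q) *P r ≋ (p *P r) +P (q *P r)
*P-distribʳ p q r = ≋-by-lin λ m → begin
  lin (δ m) ((p +P q) *P r)                          ≡⟨ lin-*P (δ m) (p +P q) r ⟩
  lin (λ a → lin (λ b → δ m (a ·m b)) r) (p +P q)    ≡⟨ lin-+P _ p q ⟩
  lin _ p ℚ.+ lin _ q                                ≡⟨ sym (cong₂ ℚ._+_ (lin-*P (δ m) p r) (lin-*P (δ m) q r)) ⟩
  lin (δ m) (p *P r) ℚ.+ lin (δ m) (q *P r)          ≡⟨ sym (lin-+P (δ m) (p *P r) (q *P r)) ⟩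
  lin (δ m) ((p *P r) +P (q *P r))                   ∎
  where open ≡-Reasoning

*P-zeroʳ : (p : Poly k) → p *P 0P ≋ 0P
*P-zeroʳ p = ≋-by-lin λ m → trans (lin-*P (δ m) p []) (lin-0ᶠ p)

*P-identityˡ : (p : Poly k) → 1P *P p ≋ p
*P-identityˡ p = ≋-by-lin λ m → trans (lin-*P (δ m) 1P p)
  (trans (ℚ.+-identityʳ _) (trans (ℚ.*-identityˡ _) (lin-congᶠ p (λ b → cong (δ m) (·m-identityˡ b)))))

scale-*Pˡ : ∀ c (p q : Poly k) → scale c p *P q ≋ scale c (p *P q)
scale-*Pˡ c p q = ≋-by-lin λ m → trans (lin-*P (δ m) (scale c p) q) (trans (lin-scale _ c p)
  (sym (trans (lin-scale (δ m) c (p *P q)) (cong (c ℚ.*_) (lin-*P (δ m) p q)))))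

scale-*Pʳ : ∀ c (p q : Poly k) → p *P scale c q ≋ scale c (p *P q)
scale-*Pʳ c p q = ≋-trans (*P-comm p (scale c q)) (≋-trans (scale-*Pˡ c q p) (scale-cong c (*P-comm q p)))

+P-interchange : (a b c d : Poly k) → (a +P b) +P (c +P d) ≋ (a +P c) +P (b +P d)
+P-interchange a b c d = mk≋ λ m → begin
  coeff ((a +P b) +P (c +P d)) m
    ≡⟨ trans (coeff-+P (a +P b) _ m) (cong₂ ℚ._+_ (coeff-+P a b m) (coeff-+P c d m)) ⟩
  (coeff a m ℚ.+ coeff b m) ℚ.+ (coeff c m ℚ.+ coeff d m)
    ≡⟨ solve 4 (λ x y u v → (x :+ y) :+ (u :+ v) := (x :+ u) :+ (y :+ v)) refl
               (coeff a m) (coeff b m) (coeff c m) (coeff d m) ⟩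
  (coeff a m ℚ.+ coeff c m) ℚ.+ (coeff b m ℚ.+ coeff d m)
    ≡⟨ sym (trans (coeff-+P (a +P c) _ m) (cong₂ ℚ._+_ (coeff-+P a c m) (coeff-+P b d m))) ⟩
  coeff ((a +P c) +P (b +P d)) m
    ∎
  where open ≡-Reasoning

-P-+P-cancel : (p q : Poly k) → p ≋ (p -P q) +P q
-P-+P-cancel p q = mk≋ λ m → sym (trans (coeff-+P (p -P q) q m) (trans (cong (ℚ._+ coeff q m) (coeff--P p q m))
  (solve 2 (λ x y → (x :+ :- y) :+ y := x) refl (coeff p m) (coeff q m))))

-P--P-cancel : (p r : Poly k) → r ≋ p -P (p -P r)
-P--P-cancel p r = mk≋ λ m → sym (trans (coeff--P p (p -P r) m) (trans (cong (λ x → coeff p m ℚ.- x) (coeff--P p r m))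
  (solve 2 (λ x y → x :+ :- (x :+ :- y) := y) refl (coeff p m) (coeff r m))))

+P--P-cancel : (p q : Poly k) → p +P (q -P p) ≋ q
+P--P-cancel p q = mk≋ λ m → trans (coeff-+P p (q -P p) m) (trans (cong (coeff p m ℚ.+_) (coeff--P q p m))
  (solve 2 (λ x y → x :+ (y :+ :- x) := y) refl (coeff p m) (coeff q m)))

-P-scale : ∀ s (p : Poly k) → p -P scale s p ≋ scale (1ℚ ℚ.- s) p
-P-scale s p = mk≋ λ m → begin
  coeff (p -P scale s p) m                     ≡⟨ coeff--P p (scale s p) m ⟩
  coeff p m ℚ.- coeff (scale s p) m            ≡⟨ cong (λ x → coeff p m ℚ.- x) (coeff-scale s p m) ⟩
  coeff p m ℚ.- s ℚ.* coeff p m                ≡⟨ solve 2 (λ x s → x :+ :- (s :* x) := (con 1ℚ :+ :- s) :* x) refl (coeff p m) s ⟩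
  (1ℚ ℚ.- s) ℚ.* coeff p m                     ≡⟨ sym (coeff-scale (1ℚ ℚ.- s) p m) ⟩
  coeff (scale (1ℚ ℚ.- s) p) m                 ∎
  where open ≡-Reasoning

complement-split : (w x : Poly k) → x ≋ (w *P x) +P ((1P -P w) *P x)
complement-split w x = ≋-sym (begin
  (w *P x) +P ((1P -P w) *P x)
    ≈⟨ +P-cong (≋-refl {p = w *P x}) (*P-distribʳ 1P (scale (ℚ.- 1ℚ) w) x) ⟩
  (w *P x) +P ((1P *P x) +P (scale (ℚ.- 1ℚ) w *P x))
    ≈⟨ +P-cong (≋-refl {p = w *P x}) (+P-cong (*P-identityˡ x) (scale-*Pˡ (ℚ.- 1ℚ) w x)) ⟩
  (w *P x) +P (x -P (w *P x))
    ≈⟨ +P--P-cancel (w *P x) x ⟩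
  x
    ∎)
  where open ≋-Reasoning

record IsIdeal (C : Poly k → Set) : Set where
  field
    resp     : ∀ {f g} → f ≋ g → C g → C f
    0∈       : C 0P
    +-closed : ∀ f g → C f → C g → C (f +P g)
    *-closed : ∀ u f → C f → C (u *P f)

record IsConvexCone (C : Poly k → Set) : Set where
  field
    resp         : ∀ {f g} → f ≋ g → C g → C f
    0∈           : C 0P
    +-closed     : ∀ f g → C f → C g → C (f +P g)
    scale-closed : ∀ c f → 0ℚ ℚ.≤ c → C f → C (scale c f)

record IsRingHom {k k′ : ℕ} (φ : Poly k → Poly k′) : Set where
  field
    resp   : ∀ {f g} → f ≋ g → φ f ≋ φ g
    0-homo : φ 0P ≋ 0P
    +-homo : ∀ f g → φ (f +P g) ≋ φ f +P φ g
    *-homo : ∀ f g → φ (f *P g) ≋ φ f *P φ g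

record IsLinear {k k′ : ℕ} (φ : Poly k → Poly k′) : Set where
  field
    resp       : ∀ {f g} → f ≋ g → φ f ≋ φ g
    0-homo     : φ 0P ≋ 0P
    +-homo     : ∀ f g → φ (f +P g) ≋ φ f +P φ g
    scale-homo : ∀ c f → φ (scale c f) ≋ scale c (φ f)

module _ {k k′ : ℕ} {φ : Poly k → Poly k′} {C : Poly k′ → Set} where

  IsIdeal-preimage : IsRingHom φ → IsIdeal C → IsIdeal (λ f → C (φ f))
  IsIdeal-preimage hom I = record
    { resp     = λ f≋g → I.resp (H.resp f≋g)
    ; 0∈       = I.resp H.0-homo I.0∈
    ; +-closed = λ f g Cf Cg → I.resp (H.+-homo f g) (I.+-closed (φ f) (φ g) Cf Cg)
    ; *-closed = λ u f Cf → I.resp (H.*-homo u f) (I.*-closed (φ u) (φ f) Cf) }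
    where
    module I = IsIdeal I
    module H = IsRingHom hom

  IsConvexCone-preimage : IsLinear φ → IsConvexCone C → IsConvexCone (λ f → C (φ f))
  IsConvexCone-preimage lin I = record
    { resp         = λ f≋g → I.resp (H.resp f≋g)
    ; 0∈           = I.resp H.0-homo I.0∈
    ; +-closed     = λ f g Cf Cg → I.resp (H.+-homo f g) (I.+-closed (φ f) (φ g) Cf Cg)
    ; scale-closed = λ c f c≥0 Cf → I.resp (H.scale-homo c f) (I.scale-closed c (φ f) c≥0 Cf) }
    where
    module I = IsConvexCone I
    module H = IsLinear lin

IsIdeal-colon : {C : Poly k → Set} (w : Poly k) → IsIdeal C → IsIdeal (λ f → C (w *P f))
IsIdeal-colon {C = C} w I = record
  { resp     = λ f≋g → I.resp (*P-congʳ w f≋g)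
  ; 0∈       = I.resp (*P-zeroʳ w) I.0∈
  ; +-closed = λ f g Cf Cg → I.resp (*P-distribˡ w f g) (I.+-closed _ _ Cf Cg)
  ; *-closed = λ u f Cf → I.resp (swap u f) (I.*-closed u (w *P f) Cf) }
  where
  module I = IsIdeal I
  swap : ∀ u f → w *P (u *P f) ≋ u *P (w *P f)
  swap u f = ≋-trans (≋-sym (*P-assoc w u f)) (≋-trans (*P-congˡ f (*P-comm w u)) (*P-assoc u w f))

*P-isLinear : (w : Poly k) → IsLinear (w *P_)
*P-isLinear w = record
  { resp = *P-congʳ w ; 0-homo = *P-zeroʳ w ; +-homo = *P-distribˡ w ; scale-homo = λ c f → scale-*Pʳ c w f }

∘-isLinear : ∀ {k k′ k″} {φ : Poly k → Poly k′} {ψ : Poly k′ → Poly k″} →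
             IsLinear ψ → IsLinear φ → IsLinear (λ f → ψ (φ f))
∘-isLinear {φ = φ} {ψ} Ψ Φ = record
  { resp       = λ e → Ψ.resp (Φ.resp e)
  ; 0-homo     = ≋-trans (Ψ.resp Φ.0-homo) Ψ.0-homo
  ; +-homo     = λ f g → ≋-trans (Ψ.resp (Φ.+-homo f g)) (Ψ.+-homo (φ f) (φ g))
  ; scale-homo = λ c f → ≋-trans (Ψ.resp (Φ.scale-homo c f)) (Ψ.scale-homo c (φ f)) }
  where
  module Ψ = IsLinear Ψ
  module Φ = IsLinear Φ

idealSum : List (Poly k × Poly k) → Poly k
idealSum hs = sumP (map (λ { (h , z) → h *P z }) hs)

coneSum : List (ℚ × Poly k) → Poly k
coneSum cs = sumP (map (λ { (c , p) → scale c p }) cs)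

module _ {S : Pred (Poly k) 0ℓ} where

  InIdeal-resp : {f g : Poly k} → f ≋ g → InIdeal S g → InIdeal S f
  InIdeal-resp {g = g} f≋g (hs , gens , g≈) = hs , gens , ≋⇒≈ (≋-trans f≋g (mk≋ {p = g} {idealSum hs} g≈))

  InIdeal-0 : InIdeal S 0P
  InIdeal-0 = [] , All.[] , (λ _ → refl)

  InIdeal-+ : ∀ f g → InIdeal S f → InIdeal S g → InIdeal S (f +P g)
  InIdeal-+ f g (hs , gens , f≈) (hs′ , gens′ , g≈) =
    hs List.++ hs′ , ++⁺ gens gens′ ,
    ≋⇒≈ (≋-trans (+P-cong (mk≋ {p = f} {idealSum hs} f≈) (mk≋ {p = g} {idealSum hs′} g≈)) (≡⇒≋ (sym (sum-++ hs hs′))))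
    where
    sum-++ : ∀ (hs hs′ : List (Poly k × Poly k)) → idealSum (hs List.++ hs′) ≡ idealSum hs +P idealSum hs′
    sum-++ []             hs′ = refl
    sum-++ ((h , z) ∷ hs) hs′ = trans (cong ((h *P z) +P_) (sum-++ hs hs′)) (sym (List.++-assoc (h *P z) (idealSum hs) (idealSum hs′)))

  InIdeal-* : ∀ u f → InIdeal S f → InIdeal S (u *P f)
  InIdeal-* u f (hs , gens , f≈) =
    map (λ { (h , z) → (u *P h , z) }) hs , gens′ hs gens ,
    ≋⇒≈ (≋-trans (*P-congʳ u (mk≋ {p = f} {idealSum hs} f≈)) (distrib hs))
    where
    distrib : ∀ hs → u *P idealSum hs ≋ idealSum (map (λ { (h , z) → (u *P h , z) }) hs)
    distrib []             = *P-zeroʳ u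
    distrib ((h , z) ∷ hs) = ≋-trans (*P-distribˡ u (h *P z) (idealSum hs)) (+P-cong (≋-sym (*P-assoc u h z)) (distrib hs))
    gens′ : ∀ hs → All (λ { (h , z) → S z }) hs → All (λ { (h , z) → S z }) (map (λ { (h , z) → (u *P h , z) }) hs)
    gens′ []       All.[]        = All.[]
    gens′ (_ ∷ hs) (Sz All.∷ Ss) = Sz All.∷ gens′ hs Ss

  InIdeal-gen : ∀ {z} → S z → InIdeal S z
  InIdeal-gen {z} Sz = (1P , z) ∷ [] , Sz All.∷ All.[] , ≋⇒≈ (≋-sym (≋-trans (+P-identityʳ (1P *P z)) (*P-identityˡ z)))

  InIdeal-scale : ∀ c f → InIdeal S f → InIdeal S (scale c f)
  InIdeal-scale c f If =
    InIdeal-resp (≋-sym (≋-trans (scale-*Pˡ c 1P f) (scale-cong c (*P-identityˡ f)))) (InIdeal-* (scale c 1P) f If)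

  InIdeal-isIdeal : IsIdeal (InIdeal S)
  InIdeal-isIdeal = record { resp = InIdeal-resp ; 0∈ = InIdeal-0 ; +-closed = InIdeal-+ ; *-closed = InIdeal-* }

  InIdeal-isConvexCone : IsConvexCone (InIdeal S)
  InIdeal-isConvexCone = record
    { resp = InIdeal-resp ; 0∈ = InIdeal-0 ; +-closed = InIdeal-+ ; scale-closed = λ c f _ → InIdeal-scale c f }

  InIdeal-least : {C : Poly k → Set} → IsIdeal C → (∀ z → S z → C z) → ∀ f → InIdeal S f → C f
  InIdeal-least {C} I S⊆C f (hs , gens , f≈) = I.resp (mk≋ {p = f} {idealSum hs} f≈) (sum hs gens)
    where
    module I = IsIdeal I
    sum : ∀ hs → All (λ { (h , z) → S z }) hs → C (idealSum hs)
    sum []             All.[]        = I.0∈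
    sum ((h , z) ∷ hs) (Sz All.∷ Ss) = I.+-closed _ _ (I.*-closed h z (S⊆C z Sz)) (sum hs Ss)

module _ {P : List (Poly k)} where

  InCone-resp : {f g : Poly k} → f ≋ g → InCone P g → InCone P f
  InCone-resp {g = g} f≋g (cs , gens , g≈) = cs , gens , ≋⇒≈ (≋-trans f≋g (mk≋ {p = g} {coneSum cs} g≈))

  InCone-0 : InCone P 0P
  InCone-0 = [] , All.[] , (λ _ → refl)

  InCone-+ : ∀ f g → InCone P f → InCone P g → InCone P (f +P g)
  InCone-+ f g (cs , gens , f≈) (cs′ , gens′ , g≈) =
    cs List.++ cs′ , ++⁺ gens gens′ ,
    ≋⇒≈ (≋-trans (+P-cong (mk≋ {p = f} {coneSum cs} f≈) (mk≋ {p = g} {coneSum cs′} g≈)) (≡⇒≋ (sym (sum-++ cs cs′))))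
    where
    sum-++ : ∀ (cs cs′ : List (ℚ × Poly k)) → coneSum (cs List.++ cs′) ≡ coneSum cs +P coneSum cs′
    sum-++ []             cs′ = refl
    sum-++ ((c , p) ∷ cs) cs′ = trans (cong (scale c p +P_) (sum-++ cs cs′)) (sym (List.++-assoc (scale c p) (coneSum cs) (coneSum cs′)))

  InCone-scale : ∀ c f → 0ℚ ℚ.≤ c → InCone P f → InCone P (scale c f)
  InCone-scale c f c≥0 (cs , gens , f≈) =
    map (λ { (d , p) → (c ℚ.* d , p) }) cs , gens′ cs gens ,
    ≋⇒≈ (≋-trans (scale-cong c (mk≋ {p = f} {coneSum cs} f≈)) (distrib cs))
    where
    distrib : ∀ cs → scale c (coneSum cs) ≋ coneSum (map (λ { (d , p) → (c ℚ.* d , p) }) cs)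
    distrib []             = ≋-refl
    distrib ((d , p) ∷ cs) = ≋-trans (≡⇒≋ (scale-+P c (scale d p) (coneSum cs))) (+P-cong (scale-scale c d p) (distrib cs))
    gens′ : ∀ cs → All (λ { (d , p) → (0ℚ ℚ.≤ d) × p ∈ P }) cs →
            All (λ { (d , p) → (0ℚ ℚ.≤ d) × p ∈ P }) (map (λ { (d , p) → (c ℚ.* d , p) }) cs)
    gens′ []             All.[]                 = All.[]
    gens′ ((d , p) ∷ cs) ((d≥0 , p∈P) All.∷ gs) =
      (ℚ.nonNegative⁻¹ _ {{ℚ.nonNeg*nonNeg⇒nonNeg c {{ℚ.nonNegative c≥0}} d {{ℚ.nonNegative d≥0}}}} , p∈P) All.∷ gens′ cs gs

  InCone-gen : ∀ {p} → p ∈ P → InCone P p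
  InCone-gen {p} p∈P = (1ℚ , p) ∷ [] , (ℚ.nonNegative⁻¹ 1ℚ , p∈P) All.∷ All.[] ,
    ≋⇒≈ (≋-sym (≋-trans (+P-identityʳ (scale 1ℚ p)) (scale-identity p)))

  InCone-isConvexCone : IsConvexCone (InCone P)
  InCone-isConvexCone = record { resp = InCone-resp ; 0∈ = InCone-0 ; +-closed = InCone-+ ; scale-closed = InCone-scale }

  InCone-least : {C : Poly k → Set} → IsConvexCone C → (∀ p → p ∈ P → C p) → ∀ f → InCone P f → C f
  InCone-least {C} I P⊆C f (cs , gens , f≈) = I.resp (mk≋ {p = f} {coneSum cs} f≈) (sum cs gens)
    where
    module I = IsConvexCone I
    sum : ∀ cs → All (λ { (c , p) → (0ℚ ℚ.≤ c) × p ∈ P }) cs → C (coneSum cs)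
    sum []             All.[]                 = I.0∈
    sum ((c , p) ∷ cs) ((c≥0 , p∈P) All.∷ gs) = I.+-closed _ _ (I.scale-closed c p c≥0 (P⊆C p p∈P)) (sum cs gs)

  InCone-support : ∀ f m → InCone P f → coeff f m ≢ 0ℚ → Σ[ r ∈ Poly k ] r ∈ P × coeff r m ≢ 0ℚ
  InCone-support f m (cs , gens , f≈) f≢0 = search cs gens (λ s₀ → f≢0 (trans (f≈ m) s₀))
    where
    search : ∀ cs → All (λ { (c , p) → (0ℚ ℚ.≤ c) × p ∈ P }) cs → coeff (coneSum cs) m ≢ 0ℚ →
             Σ[ r ∈ Poly k ] r ∈ P × coeff r m ≢ 0ℚ
    search []             All.[]              s≢0 = ⊥-elim (s≢0 refl)
    search ((c , p) ∷ cs) ((_ , p∈P) All.∷ gs) s≢0 with coeff p m ℚ.≟ 0ℚ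
    ... | no  p≢0 = p , p∈P , p≢0
    ... | yes p₀  = search cs gs λ s₀ → s≢0 (begin
      coeff (scale c p +P coneSum cs) m             ≡⟨ coeff-+P (scale c p) (coneSum cs) m ⟩
      coeff (scale c p) m ℚ.+ coeff (coneSum cs) m  ≡⟨ cong₂ ℚ._+_ (trans (coeff-scale c p m) (cong (c ℚ.*_) p₀)) s₀ ⟩
      c ℚ.* 0ℚ ℚ.+ 0ℚ                               ≡⟨ cong (ℚ._+ 0ℚ) (ℚ.*-zeroʳ c) ⟩
      0ℚ                                            ∎)
      where open ≡-Reasoning

module _ {S : Pred (Poly k) 0ℓ} {P : List (Poly k)} where

  InAlgCone-resp : {f g : Poly k} → f ≋ g → InAlgCone S P g → InAlgCone S P f
  InAlgCone-resp {g = g} f≋g (a , b , Ia , Cb , g≈) = a , b , Ia , Cb , ≋⇒≈ (≋-trans f≋g (mk≋ {p = g} {a +P b} g≈))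

  InAlgCone-+ : ∀ f g → InAlgCone S P f → InAlgCone S P g → InAlgCone S P (f +P g)
  InAlgCone-+ f g (a , b , Ia , Cb , f≈) (a′ , b′ , Ia′ , Cb′ , g≈) =
    a +P a′ , b +P b′ , InIdeal-+ a a′ Ia Ia′ , InCone-+ b b′ Cb Cb′ ,
    ≋⇒≈ (≋-trans (+P-cong (mk≋ {p = f} {a +P b} f≈) (mk≋ {p = g} {a′ +P b′} g≈)) (+P-interchange a b a′ b′))

  InAlgCone-scale : ∀ c f → 0ℚ ℚ.≤ c → InAlgCone S P f → InAlgCone S P (scale c f)
  InAlgCone-scale c f c≥0 (a , b , Ia , Cb , f≈) =
    scale c a , scale c b , InIdeal-scale c a Ia , InCone-scale c b c≥0 Cb ,
    ≋⇒≈ (≋-trans (scale-cong c (mk≋ {p = f} {a +P b} f≈)) (≡⇒≋ (scale-+P c a b)))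

  InIdeal⇒InAlgCone : ∀ f → InIdeal S f → InAlgCone S P f
  InIdeal⇒InAlgCone f If = f , 0P , If , InCone-0 , ≋⇒≈ (≋-sym (+P-identityʳ f))

  InCone⇒InAlgCone : ∀ f → InCone P f → InAlgCone S P f
  InCone⇒InAlgCone f Cf = 0P , f , InIdeal-0 , Cf , (λ _ → refl)

  InAlgCone-isConvexCone : IsConvexCone (InAlgCone S P)
  InAlgCone-isConvexCone = record
    { resp = InAlgCone-resp ; 0∈ = InIdeal⇒InAlgCone 0P InIdeal-0
    ; +-closed = InAlgCone-+ ; scale-closed = InAlgCone-scale }

  InAlgCone-least : {C : Poly k → Set} → IsConvexCone C → (∀ f → InIdeal S f → C f) → (∀ p → p ∈ P → C p) →
                    ∀ f → InAlgCone S P f → C f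
  InAlgCone-least I S⊆C P⊆C f (a , b , Ia , Cb , f≈) =
    I.resp (mk≋ {p = f} {a +P b} f≈) (I.+-closed a b (S⊆C a Ia) (InCone-least I P⊆C b Cb))
    where module I = IsConvexCone I

take-++ : ∀ {A : Set} {n m} (x : Vec A n) (y : Vec A m) → Vec.take n (x Vec.++ y) ≡ x
take-++ Vec.[]       y = refl
take-++ (a Vec.∷ x) y = cong (a Vec.∷_) (take-++ x y)

drop-++ : ∀ {A : Set} {n m} (x : Vec A n) (y : Vec A m) → Vec.drop n (x Vec.++ y) ≡ y
drop-++ Vec.[]       y = refl
drop-++ (a Vec.∷ x) y = drop-++ x y

oneM-++ : ∀ n {m} → oneM {n} Vec.++ oneM {m} ≡ oneM {n + m}
oneM-++ zero    = refl
oneM-++ (suc n) = cong (0 Vec.∷_) (oneM-++ n)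

module LastVariable (n : ℕ) where

  InX : Mono (n + 1) → Set
  InX a = Vec.drop n a ≡ oneM

  InX-·m : ∀ {a b} → InX a → InX b → InX (a ·m b)
  InX-·m {a} {b} a∈X b∈X = trans (drop-zipWith ℕ._+_ a b) (cong₂ _·m_ a∈X b∈X)

  InX-∸ : ∀ {a b} → InX a → InX b → InX (Vec.zipWith ℕ._∸_ a b)
  InX-∸ {a} {b} a∈X b∈X = trans (drop-zipWith ℕ._∸_ a b) (cong₂ (Vec.zipWith ℕ._∸_) a∈X b∈X)

  tDegree : Mono (n + 1) → ℕ
  tDegree a = Vec.head (Vec.drop n a)

  tDegree-·m : ∀ (a b : Mono (n + 1)) → tDegree (a ·m b) ≡ tDegree a + tDegree b
  tDegree-·m a b = trans (cong Vec.head (drop-zipWith ℕ._+_ a b)) (head-+ (Vec.drop n a) (Vec.drop n b))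
    where
    head-+ : (x y : Vec ℕ 1) → Vec.head (x ·m y) ≡ Vec.head x + Vec.head y
    head-+ (x Vec.∷ Vec.[]) (y Vec.∷ Vec.[]) = refl

  evalAt : ℚ → Poly (n + 1) → Poly n
  evalAt s = map (λ { (c , a) → (c ℚ.* s ^ tDegree a , Vec.take n a) })

  lin-evalAt : ∀ F s (p : Poly (n + 1)) → lin F (evalAt s p) ≡ lin (λ a → s ^ tDegree a ℚ.* F (Vec.take n a)) p
  lin-evalAt F s []            = refl
  lin-evalAt F s ((c , a) ∷ p) = cong₂ ℚ._+_ (ℚ.*-assoc c _ _) (lin-evalAt F s p)

  lin-embed : ∀ F (p : Poly n) → lin F (embed 1 p) ≡ lin (λ a → F (a Vec.++ oneM {1})) p
  lin-embed F []            = refl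
  lin-embed F ((c , a) ∷ p) = cong (c ℚ.* F (a Vec.++ oneM {1}) ℚ.+_) (lin-embed F p)

  evalAt-embed : ∀ s (p : Poly n) → evalAt s (embed 1 p) ≡ p
  evalAt-embed s []            = refl
  evalAt-embed s ((c , a) ∷ p) = cong₂ _∷_
    (cong₂ _,_ (trans (cong (λ v → c ℚ.* s ^ Vec.head v) (drop-++ a (oneM {1}))) (ℚ.*-identityʳ c)) (take-++ a (oneM {1})))
    (evalAt-embed s p)

  evalAt-·m : ∀ s m (a b : Mono (n + 1)) →
              s ^ tDegree (a ·m b) ℚ.* δ m (Vec.take n (a ·m b)) ≡
              s ^ tDegree a ℚ.* (s ^ tDegree b ℚ.* δ m (Vec.take n a ·m Vec.take n b))
  evalAt-·m s m a b = begin
    s ^ tDegree (a ·m b) ℚ.* δ m (Vec.take n (a ·m b))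
      ≡⟨ cong₂ (λ d v → s ^ d ℚ.* δ m v) (tDegree-·m a b) (take-zipWith ℕ._+_ a b) ⟩
    s ^ (tDegree a + tDegree b) ℚ.* δ m (Vec.take n a ·m Vec.take n b)
      ≡⟨ cong (ℚ._* _) (^-homo-* s (tDegree a) (tDegree b)) ⟩
    (s ^ tDegree a ℚ.* s ^ tDegree b) ℚ.* δ m (Vec.take n a ·m Vec.take n b)
      ≡⟨ ℚ.*-assoc (s ^ tDegree a) (s ^ tDegree b) _ ⟩
    s ^ tDegree a ℚ.* (s ^ tDegree b ℚ.* δ m (Vec.take n a ·m Vec.take n b))
      ∎
    where open ≡-Reasoning

  evalAt-*P : ∀ s (f g : Poly (n + 1)) → evalAt s (f *P g) ≋ evalAt s f *P evalAt s g
  evalAt-*P s f g = ≋-by-lin λ m → begin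
    lin (δ m) (evalAt s (f *P g))
      ≡⟨ trans (lin-evalAt (δ m) s (f *P g)) (lin-*P _ f g) ⟩
    lin (λ a → lin (λ b → s ^ tDegree (a ·m b) ℚ.* δ m (Vec.take n (a ·m b))) g) f
      ≡⟨ lin-congᶠ f (λ a → lin-congᶠ g (evalAt-·m s m a)) ⟩
    lin (λ a → lin (λ b → s ^ tDegree a ℚ.* (s ^ tDegree b ℚ.* δ m (Vec.take n a ·m Vec.take n b))) g) f
      ≡⟨ lin-congᶠ f (λ a → lin-*ᶠ (s ^ tDegree a) _ g) ⟩
    lin (λ a → s ^ tDegree a ℚ.* lin (λ b → s ^ tDegree b ℚ.* δ m (Vec.take n a ·m Vec.take n b)) g) f
      ≡⟨ sym (lin-congᶠ f (λ a → cong (s ^ tDegree a ℚ.*_) (lin-evalAt _ s g))) ⟩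
    lin (λ a → s ^ tDegree a ℚ.* lin (λ b → δ m (Vec.take n a ·m b)) (evalAt s g)) f
      ≡⟨ sym (trans (lin-*P (δ m) (evalAt s f) (evalAt s g)) (lin-evalAt _ s f)) ⟩
    lin (δ m) (evalAt s f *P evalAt s g)
      ∎
    where open ≡-Reasoning

  evalAt-isRingHom : ∀ s → IsRingHom (evalAt s)
  evalAt-isRingHom s = record
    { resp   = λ {f} {g} e → ≋-by-lin λ m →
                 trans (lin-evalAt (δ m) s f) (trans (lin-resp-≋ _ e) (sym (lin-evalAt (δ m) s g)))
    ; 0-homo = ≋-refl
    ; +-homo = λ f g → ≡⇒≋ (List.map-++ _ f g)
    ; *-homo = evalAt-*P s }

  evalAt-isLinear : ∀ s → IsLinear (evalAt s)
  evalAt-isLinear s = record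
    { resp = H.resp ; 0-homo = H.0-homo ; +-homo = H.+-homo
    ; scale-homo = λ c f → ≋-by-lin λ m → trans (lin-evalAt (δ m) s (scale c f)) (trans (lin-scale _ c f)
        (sym (trans (lin-scale (δ m) c (evalAt s f)) (cong (c ℚ.*_) (lin-evalAt _ s f))))) }
    where module H = IsRingHom (evalAt-isRingHom s)

  embed-isRingHom : IsRingHom (embed {n} 1)
  embed-isRingHom = record
    { resp   = λ {f} {g} e → ≋-by-lin λ m → trans (lin-embed (δ m) f) (trans (lin-resp-≋ _ e) (sym (lin-embed (δ m) g)))
    ; 0-homo = ≋-refl
    ; +-homo = λ f g → ≡⇒≋ (List.map-++ _ f g)
    ; *-homo = λ f g → ≋-by-lin λ m → begin
        lin (δ m) (embed 1 (f *P g))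
          ≡⟨ trans (lin-embed (δ m) (f *P g)) (lin-*P _ f g) ⟩
        lin (λ a → lin (λ b → δ m ((a ·m b) Vec.++ oneM {1})) g) f
          ≡⟨ lin-congᶠ f (λ a → lin-congᶠ g (λ b → cong (δ m) (sym (zipWith-++ ℕ._+_ a (oneM {1}) b (oneM {1}))))) ⟩
        lin (λ a → lin (λ b → δ m ((a Vec.++ oneM {1}) ·m (b Vec.++ oneM {1}))) g) f
          ≡⟨ sym (trans (lin-*P (δ m) (embed 1 f) (embed 1 g)) (trans (lin-embed _ f) (lin-congᶠ f (λ a → lin-embed _ g)))) ⟩
        lin (δ m) (embed 1 f *P embed 1 g)
          ∎ }
    where open ≡-Reasoning

  embed-isLinear : IsLinear (embed {n} 1)
  embed-isLinear = record
    { resp = H.resp ; 0-homo = H.0-homo ; +-homo = H.+-homo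
    ; scale-homo = λ c f → ≋-by-lin λ m → trans (lin-embed (δ m) (scale c f)) (trans (lin-scale _ c f)
        (sym (trans (lin-scale (δ m) c (embed 1 f)) (cong (c ℚ.*_) (lin-embed _ f))))) }
    where module H = IsRingHom embed-isRingHom

  embed-inSpanX : ∀ (p : Poly n) → InSpanX {n} {1} (embed 1 p)
  embed-inSpanX p a a≢0 with ≡-dec ℕ._≟_ (Vec.drop n a) oneM
  ... | yes a∈X = a∈X
  ... | no  a∉X = ⊥-elim (a≢0 (begin
    coeff (embed 1 p) a                     ≡⟨ trans (coeff≡lin (embed 1 p) a) (lin-embed (δ a) p) ⟩
    lin (λ b → δ a (b Vec.++ oneM {1})) p   ≡⟨ lin-congᶠ p (λ b → δ-≢ a (b Vec.++ oneM {1}) (a≢b++1 b)) ⟩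
    lin (λ _ → 0ℚ) p                        ≡⟨ lin-0ᶠ p ⟩
    0ℚ                                      ∎))
    where
    open ≡-Reasoning
    a≢b++1 : ∀ b → b Vec.++ oneM {1} ≢ a
    a≢b++1 b e = a∉X (trans (cong (Vec.drop n) (sym e)) (drop-++ b (oneM {1})))

  embed-evalAt : ∀ s (p : Poly (n + 1)) → InSpanX {n} {1} p → embed 1 (evalAt s p) ≋ p
  embed-evalAt s p p∈X = ≋-by-lin λ m →
    trans (lin-embed (δ m) (evalAt s p)) (trans (lin-evalAt (λ b → δ m (b Vec.++ oneM {1})) s p) (lin-congˢ p (λ a a≢0 → begin
      s ^ Vec.head (Vec.drop n a) ℚ.* δ m (Vec.take n a Vec.++ oneM {1})
        ≡⟨ cong (λ v → s ^ Vec.head v ℚ.* δ m (Vec.take n a Vec.++ oneM {1})) (p∈X a a≢0) ⟩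
      1ℚ ℚ.* δ m (Vec.take n a Vec.++ oneM {1})
        ≡⟨ ℚ.*-identityˡ _ ⟩
      δ m (Vec.take n a Vec.++ oneM {1})
        ≡⟨ cong (λ v → δ m (Vec.take n a Vec.++ v)) (sym (p∈X a a≢0)) ⟩
      δ m (Vec.take n a Vec.++ Vec.drop n a)
        ≡⟨ cong (δ m) (take++drop≡id n a) ⟩
      δ m a
        ∎)))
    where open ≡-Reasoning

  evalAt-tVar : ∀ s → evalAt s (tVar {n}) ≡ scale s 1P
  evalAt-tVar s = cong (_∷ []) (cong₂ _,_
    (trans (cong (λ v → 1ℚ ℚ.* s ^ Vec.head v) (drop-++ (oneM {n}) (1 Vec.∷ Vec.[]))) (ℚ.*-identityˡ (s ℚ.* 1ℚ)))
    (take-++ (oneM {n}) (1 Vec.∷ Vec.[])))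

  evalAt-1P : ∀ s → evalAt s (1P {n + 1}) ≡ 1P
  evalAt-1P s = cong (_∷ []) (cong₂ _,_
    (trans (cong (λ v → 1ℚ ℚ.* s ^ tDegree v) (sym (oneM-++ n)))
           (trans (cong (λ v → 1ℚ ℚ.* s ^ Vec.head v) (drop-++ (oneM {n}) (oneM {1}))) (ℚ.*-identityˡ 1ℚ)))
    (trans (cong (Vec.take n) (sym (oneM-++ n))) (take-++ (oneM {n}) (oneM {1}))))

  evalAt-1-t : ∀ s → evalAt s (1P -P tVar) ≋ scale (1ℚ ℚ.- s) 1P
  evalAt-1-t s = begin
    evalAt s (1P -P tVar)                          ≈⟨ H.+-homo 1P (scale (ℚ.- 1ℚ) (tVar {n})) ⟩
    evalAt s 1P +P evalAt s (scale (ℚ.- 1ℚ) tVar)  ≈⟨ +P-cong (≡⇒≋ (evalAt-1P s)) (L.scale-homo (ℚ.- 1ℚ) (tVar {n})) ⟩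
    1P +P scale (ℚ.- 1ℚ) (evalAt s tVar)           ≡⟨ cong (λ q → 1P +P scale (ℚ.- 1ℚ) q) (evalAt-tVar s) ⟩
    1P -P scale s 1P                               ≈⟨ -P-scale s 1P ⟩
    scale (1ℚ ℚ.- s) 1P                            ∎
    where
    open ≋-Reasoning
    module H = IsRingHom (evalAt-isRingHom s)
    module L = IsLinear (evalAt-isLinear s)

  evalAt-*embed : ∀ s c w (z : Poly n) → evalAt s w ≋ scale c 1P → evalAt s (w *P embed 1 z) ≋ scale c z
  evalAt-*embed s c w z w↦c = begin
    evalAt s (w *P embed 1 z)                 ≈⟨ IsRingHom.*-homo (evalAt-isRingHom s) w (embed 1 z) ⟩
    evalAt s w *P evalAt s (embed 1 z)        ≈⟨ *P-congˡ _ w↦c ⟩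
    scale c 1P *P evalAt s (embed 1 z)        ≡⟨ cong (scale c 1P *P_) (evalAt-embed s z) ⟩
    scale c 1P *P z                           ≈⟨ scale-*Pˡ c 1P z ⟩
    scale c (1P *P z)                         ≈⟨ scale-cong c (*P-identityˡ z) ⟩
    scale c z                                 ∎
    where open ≋-Reasoning

  module _ (Z₁ Z₂ : List (Poly n)) where

    t*embed∈interZ : ∀ {z} → z ∈ Z₁ → tVar *P embed 1 z ∈ interZ Z₁ Z₂
    t*embed∈interZ z∈ = ∈-++⁺ˡ (∈-map⁺ (λ z → tVar *P embed 1 z) z∈)

    [1-t]*embed∈interZ : ∀ {z} → z ∈ Z₂ → (1P -P tVar) *P embed 1 z ∈ interZ Z₁ Z₂
    [1-t]*embed∈interZ z∈ = ∈-++⁺ʳ (map (λ z → tVar *P embed 1 z) Z₁) (∈-map⁺ (λ z → (1P -P tVar) *P embed 1 z) z∈)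

    evalAt-interZ : ∀ s x → x ∈ interZ Z₁ Z₂ →
      (Σ[ z ∈ Poly n ] z ∈ Z₁ × evalAt s x ≋ scale s z) ⊎ (Σ[ z ∈ Poly n ] z ∈ Z₂ × evalAt s x ≋ scale (1ℚ ℚ.- s) z)
    evalAt-interZ s x x∈ with ∈-++⁻ (map (λ z → tVar *P embed 1 z) Z₁) x∈
    ... | inj₁ x∈₁ with ∈-map⁻ (λ z → tVar *P embed 1 z) x∈₁
    ...   | z , z∈ , refl = inj₁ (z , z∈ , evalAt-*embed s s tVar z (≡⇒≋ (evalAt-tVar s)))
    evalAt-interZ s x x∈ | inj₂ x∈₂ with ∈-map⁻ (λ z → (1P -P tVar) *P embed 1 z) x∈₂
    ...   | z , z∈ , refl = inj₂ (z , z∈ , evalAt-*embed s (1ℚ ℚ.- s) (1P -P tVar) z (evalAt-1-t s))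

    evalAt-1-interZ : {C : Poly n → Set} → IsConvexCone C → (∀ z → z ∈ Z₁ → C z) → ∀ x → x ∈ interZ Z₁ Z₂ → C (evalAt 1ℚ x)
    evalAt-1-interZ I Z₁⊆C x x∈ with evalAt-interZ 1ℚ x x∈
    ... | inj₁ (z , z∈ , e) = IsConvexCone.resp I (≋-trans e (scale-identity z)) (Z₁⊆C z z∈)
    ... | inj₂ (z , _  , e) = IsConvexCone.resp I (≋-trans e (scale-zero z)) (IsConvexCone.0∈ I)

    evalAt-0-interZ : {C : Poly n → Set} → IsConvexCone C → (∀ z → z ∈ Z₂ → C z) → ∀ x → x ∈ interZ Z₁ Z₂ → C (evalAt 0ℚ x)
    evalAt-0-interZ I Z₂⊆C x x∈ with evalAt-interZ 0ℚ x x∈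
    ... | inj₁ (z , _  , e) = IsConvexCone.resp I (≋-trans e (scale-zero z)) (IsConvexCone.0∈ I)
    ... | inj₂ (z , z∈ , e) = IsConvexCone.resp I (≋-trans e (scale-identity z)) (Z₂⊆C z z∈)

nonzero-summandˡ : ∀ x y → x ℚ.+ y ≡ 0ℚ → y ≢ 0ℚ → x ≢ 0ℚ
nonzero-summandˡ x y x+y≡0 y≢0 x≡0 = y≢0 (trans (sym (ℚ.+-identityˡ y)) (trans (cong (ℚ._+ y) (sym x≡0)) x+y≡0))

nonzero-summandʳ : ∀ x y → x ℚ.+ y ≡ 0ℚ → x ≢ 0ℚ → y ≢ 0ℚ
nonzero-summandʳ x y x+y≡0 x≢0 y≡0 = x≢0 (trans (sym (ℚ.+-identityʳ x)) (trans (cong (x ℚ.+_) (sym y≡0)) x+y≡0))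

support--P : ∀ (p q : Poly k) m → coeff (p -P q) m ≢ 0ℚ → coeff p m ≢ 0ℚ ⊎ coeff q m ≢ 0ℚ
support--P p q m ≢0 with coeff q m ℚ.≟ 0ℚ
... | no  q≢0 = inj₂ q≢0
... | yes q≡0 = inj₁ λ p≡0 → ≢0 (begin
  coeff (p -P q) m           ≡⟨ coeff--P p q m ⟩
  coeff p m ℚ.- coeff q m    ≡⟨ cong₂ ℚ._-_ p≡0 q≡0 ⟩
  0ℚ ℚ.- 0ℚ                  ≡⟨⟩
  0ℚ                         ∎)
  where open ≡-Reasoning

support : Poly k → List (Mono k)
support p = List.filter (λ a → ¬? (coeff p a ℚ.≟ 0ℚ)) (map proj₂ p)

∈-support : ∀ (p : Poly k) {a} → coeff p a ≢ 0ℚ → a ∈ support p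
∈-support p {a} a≢0 = ∈-filter⁺ (λ a → ¬? (coeff p a ℚ.≟ 0ℚ)) (∈-monomials p a≢0) a≢0
  where
  ∈-monomials : ∀ (p : Poly k) {a} → coeff p a ≢ 0ℚ → a ∈ map proj₂ p
  ∈-monomials []            a≢0 = ⊥-elim (a≢0 refl)
  ∈-monomials ((c , b) ∷ p) {a} a≢0 with ≡-dec ℕ._≟_ b a
  ... | yes b≡a = here (sym b≡a)
  ... | no  _   = there (∈-monomials p a≢0)

support-nonzero : ∀ (p : Poly k) {a} → a ∈ support p → coeff p a ≢ 0ℚ
support-nonzero p {a} a∈ = proj₂ (∈-filter⁻ (λ a → ¬? (coeff p a ℚ.≟ 0ℚ)) {xs = map proj₂ p} a∈)

≋0P⊎nonzero : ∀ (p : Poly k) → p ≋ 0P ⊎ Σ[ a ∈ Mono k ] coeff p a ≢ 0ℚ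
≋0P⊎nonzero p with support p in eq
... | []    = inj₁ (mk≋ λ a → decidable-stable (coeff p a ℚ.≟ 0ℚ) λ a≢0 → ∉[] (subst (a ∈_) eq (∈-support p a≢0)))
... | a ∷ _ = inj₂ (a , support-nonzero p (subst (a ∈_) (sym eq) (here refl)))

module _ {A : Set} {_≤_ : A → A → Set} (T : IsTotalPreorder _≡_ _≤_) where
  open IsTotalPreorder T using (total) renaming (refl to ≤-refl; trans to ≤-trans)

  max-exists : ∀ {x} xs → x ∈ xs → Σ[ M ∈ A ] M ∈ xs × All (_≤ M) xs
  max-exists []             ()
  max-exists (y ∷ [])       _ = y , here refl , ≤-refl All.∷ All.[]
  max-exists (y ∷ z ∷ xs) _ with max-exists (z ∷ xs) (here refl)
  ... | M , M∈ , below with total y M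
  ...   | inj₁ y≤M = M , there M∈ , y≤M All.∷ below
  ...   | inj₂ M≤y = y , here refl , ≤-refl All.∷ All.map (λ x≤M → ≤-trans x≤M M≤y) below

lead-exists : {_≤_ : Mono k → Mono k → Set} → IsTotalPreorder _≡_ _≤_ →
              ∀ (p : Poly k) a → coeff p a ≢ 0ℚ → Σ[ M ∈ Mono k ] IsLM _≤_ p M × a ≤ M
lead-exists T p a a≢0 with max-exists T (support p) (∈-support p a≢0)
... | M , M∈ , below =
  M , (support-nonzero p M∈ , λ m m≢0 → All.lookup below (∈-support p m≢0)) , All.lookup below (∈-support p a≢0)

lead-or-zero : {_≤_ : Mono k → Mono k → Set} → IsTotalPreorder _≡_ _≤_ →
               ∀ (p : Poly k) → p ≋ 0P ⊎ Σ[ M ∈ Mono k ] IsLM _≤_ p M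
lead-or-zero T p with ≋0P⊎nonzero p
... | inj₁ p≋0        = inj₁ p≋0
... | inj₂ (a , a≢0) with lead-exists T p a a≢0
...   | M , lead , _  = inj₂ (M , lead)

term : ℚ → Mono k → Poly k
term c d = (c , d) ∷ []

coeff-term*P : ∀ c d (g : Poly k) m → coeff (term c d *P g) m ≡ c ℚ.* lin (λ b → δ m (d ·m b)) g
coeff-term*P c d g m = trans (coeff≡lin (term c d *P g) m) (trans (lin-*P (δ m) (term c d) g) (ℚ.+-identityʳ _))

coeff-term*P-·m : ∀ c d (g : Poly k) b → coeff (term c d *P g) (d ·m b) ≡ c ℚ.* coeff g b
coeff-term*P-·m c d g b = trans (coeff-term*P c d g (d ·m b))
  (cong (c ℚ.*_) (trans (lin-congᶠ g (δ-·m d b)) (sym (coeff≡lin g b))))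

support-term*P : ∀ c d (g : Poly k) m → coeff (term c d *P g) m ≢ 0ℚ → Σ[ b ∈ Mono k ] m ≡ d ·m b × coeff g b ≢ 0ℚ
support-term*P c d g m m≢0 with any? (λ b → ≡-dec ℕ._≟_ m (d ·m b)) (support g)
... | yes found with find found
...   | b , b∈ , m≡db = b , m≡db , support-nonzero g b∈
support-term*P c d g m m≢0 | no none = ⊥-elim (m≢0 (begin
  coeff (term c d *P g) m              ≡⟨ coeff-term*P c d g m ⟩
  c ℚ.* lin (λ b → δ m (d ·m b)) g     ≡⟨ cong (c ℚ.*_) (lin-congˢ g (λ b b≢0 → δ-≢ m (d ·m b) (m≢d·b b b≢0))) ⟩
  c ℚ.* lin (λ _ → 0ℚ) g               ≡⟨ cong (c ℚ.*_) (lin-0ᶠ g) ⟩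
  c ℚ.* 0ℚ                             ≡⟨ ℚ.*-zeroʳ c ⟩
  0ℚ                                   ∎))
  where
  open ≡-Reasoning
  m≢d·b : ∀ b → coeff g b ≢ 0ℚ → d ·m b ≢ m
  m≢d·b b b≢0 e = none (lose (∈-support g b≢0) (sym e))

∸-·m : (b a : Mono k) → a ∣m b → Vec.zipWith ℕ._∸_ b a ·m a ≡ b
∸-·m Vec.[]       Vec.[]       _   = refl
∸-·m (y Vec.∷ b) (x Vec.∷ a) a∣b = cong₂ Vec._∷_ (ℕ.m∸n+n≡m (a∣b Fin.zero)) (∸-·m b a (λ i → a∣b (Fin.suc i)))

÷-*-cancel : ∀ p q .{{_ : ℚ.NonZero q}} → (p ℚ.÷ q) ℚ.* q ≡ p
÷-*-cancel p q = trans (ℚ.*-assoc p (ℚ.1/ q) q) (trans (cong (p ℚ.*_) (ℚ.*-inverseˡ q)) (ℚ.*-identityʳ p))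

quotientCoeff : (h g : Poly k) (B mg : Mono k) → coeff g mg ≢ 0ℚ → ℚ
quotientCoeff h g B mg g≢0 = ℚ._÷_ (coeff h B) (coeff g mg) {{ℚ.≢-nonZero g≢0}}

quotientTerm : (h g : Poly k) (B mg : Mono k) → coeff g mg ≢ 0ℚ → Poly k
quotientTerm h g B mg g≢0 = term (quotientCoeff h g B mg g≢0) (Vec.zipWith ℕ._∸_ B mg)

coeff-cancel-lead : ∀ (h g : Poly k) B mg (g≢0 : coeff g mg ≢ 0ℚ) → mg ∣m B →
                    coeff (h -P (quotientTerm h g B mg g≢0 *P g)) B ≡ 0ℚ
coeff-cancel-lead {k} h g B mg g≢0 mg∣B = begin
  coeff (h -P (q *P g)) B                 ≡⟨ coeff--P h (q *P g) B ⟩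
  coeff h B ℚ.- coeff (q *P g) B          ≡⟨ cong (λ x → coeff h B ℚ.- coeff (q *P g) x) (sym (∸-·m B mg mg∣B)) ⟩
  coeff h B ℚ.- coeff (q *P g) (d ·m mg)  ≡⟨ cong (λ x → coeff h B ℚ.- x) (coeff-term*P-·m c d g mg) ⟩
  coeff h B ℚ.- c ℚ.* coeff g mg          ≡⟨ cong (λ x → coeff h B ℚ.- x) (÷-*-cancel _ _ {{ℚ.≢-nonZero g≢0}}) ⟩
  coeff h B ℚ.- coeff h B                 ≡⟨ ℚ.+-inverseʳ (coeff h B) ⟩
  0ℚ                                      ∎
  where
  open ≡-Reasoning
  c : ℚ
  c = quotientCoeff h g B mg g≢0
  d : Mono k
  d = Vec.zipWith ℕ._∸_ B mg
  q : Poly k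
  q = quotientTerm h g B mg g≢0

module _ (ord : MonomialOrder k) where
  open MonomialOrder ord
  open IsTotalOrder isTotalOrder using (total; reflexive; antisym) renaming (trans to ⪯-trans)

  oneM-minimum : ∀ x → oneM ⪯ x
  oneM-minimum x with total x oneM
  ... | inj₂ 1⪯x = 1⪯x
  ... | inj₁ x⪯1 with ≡-dec ℕ._≟_ x oneM
  ...   | yes refl = reflexive refl
  ...   | no  x≢1  = ⊥-elim (descent x (wellOrder x) x⪯1 x≢1)
    where
    -- Below 1, squaring strictly decreases, contradicting well-foundedness.
    descent : ∀ y → Acc _≺_ y → y ⪯ oneM → y ≢ oneM → ⊥
    descent y (acc smaller) y⪯1 y≢1 = descent (y ·m y) (smaller (y²⪯y , y²≢y)) (⪯-trans y²⪯y y⪯1) y²≢1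
      where
      y²⪯y : (y ·m y) ⪯ y
      y²⪯y = subst ((y ·m y) ⪯_) (·m-identityˡ y) (multiplicative y oneM y y⪯1)
      y²≢y : y ·m y ≢ y
      y²≢y e = y≢1 (·m-cancelˡ y y oneM (trans e (sym (·m-identityʳ y))))
      y²≢1 : y ·m y ≢ oneM
      y²≢1 e = y²≢y (antisym y²⪯y (subst (y ⪯_) (sym e) y⪯1))

  cancel-lead-below : ∀ (h g : Poly k) B mg (g≢0 : coeff g mg ≢ 0ℚ) → mg ∣m B →
                      (∀ m → coeff h m ≢ 0ℚ → m ⪯ B) → (∀ m → coeff g m ≢ 0ℚ → m ⪯ mg) →
                      ∀ m → coeff (h -P (quotientTerm h g B mg g≢0 *P g)) m ≢ 0ℚ → m ⪯ B
  cancel-lead-below h g B mg g≢0 mg∣B h⪯B g⪯mg m m≢0 with support--P h (quotientTerm h g B mg g≢0 *P g) m m≢0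
  ... | inj₁ h≢0  = h⪯B m h≢0
  ... | inj₂ qg≢0 with support-term*P (quotientCoeff h g B mg g≢0) (Vec.zipWith ℕ._∸_ B mg) g m qg≢0
  ...   | b , refl , b≢0 =
    subst₂ _⪯_ (·m-comm b _) (trans (·m-comm mg _) (∸-·m B mg mg∣B)) (multiplicative b mg _ (g⪯mg b b≢0))

∣m-drop-oneM : ∀ n (a b : Mono (n + 1)) → a ∣m b → Vec.drop n b ≡ oneM → Vec.drop n a ≡ oneM
∣m-drop-oneM zero    (x Vec.∷ Vec.[]) (y Vec.∷ Vec.[]) a∣b refl with a∣b Fin.zero
... | ℕ.z≤n = refl
∣m-drop-oneM (suc n) (x Vec.∷ a)      (y Vec.∷ b)      a∣b b∈X = ∣m-drop-oneM n a b (λ i → a∣b (Fin.suc i)) b∈X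

module Elimination (n : ℕ) (ord : MonomialOrder (n + 1)) where
  open MonomialOrder ord
  open IsTotalOrder isTotalOrder using (antisym) renaming (refl to ⪯-refl; trans to ⪯-trans; total to ⪯-total)
  open LastVariable n using (InX; InX-·m; InX-∸)

  _⪯ₑ_ : Mono (n + 1) → Mono (n + 1) → Set
  _⪯ₑ_ = elimOrder {n} {1} ord

  partX̄-InX : ∀ a → InX a → partX̄ {n} {1} a ≡ oneM
  partX̄-InX a a∈X = trans (cong (oneM {n} Vec.++_) a∈X) (oneM-++ n)

  partX-InX : ∀ a → InX a → partX {n} {1} a ≡ a
  partX-InX a a∈X = trans (cong (Vec.take n a Vec.++_) (sym a∈X)) (take++drop≡id n a)

  ⪯ₑ-InX : ∀ {a b} → InX b → a ⪯ₑ b → InX a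
  ⪯ₑ-InX {a} {b} b∈X (inj₁ (ā⪯b̄ , ā≢b̄)) =
    ⊥-elim (ā≢b̄ (antisym ā⪯b̄ (subst (_⪯ partX̄ {n} {1} a) (sym (partX̄-InX b b∈X)) (oneM-minimum ord _))))
  ⪯ₑ-InX {a} {b} b∈X (inj₂ (ā≡b̄ , _)) = trans (++-injectiveʳ (oneM {n}) oneM ā≡b̄) b∈X

  ⪯ₑ⇒⪯ : ∀ {a b} → InX a → InX b → a ⪯ₑ b → a ⪯ b
  ⪯ₑ⇒⪯ {a} {b} a∈X b∈X (inj₁ (_ , ā≢b̄)) = ⊥-elim (ā≢b̄ (trans (partX̄-InX a a∈X) (sym (partX̄-InX b b∈X))))
  ⪯ₑ⇒⪯ {a} {b} a∈X b∈X (inj₂ (_ , x⪯)) = subst₂ _⪯_ (partX-InX a a∈X) (partX-InX b b∈X) x⪯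

  ⪯ₑ-isTotalPreorder : IsTotalPreorder _≡_ _⪯ₑ_
  ⪯ₑ-isTotalPreorder = record
    { isPreorder = record { isEquivalence = ≡.isEquivalence ; reflexive = ⪯ₑ-reflexive ; trans = ⪯ₑ-trans }
    ; total      = ⪯ₑ-total }
    where
    ⪯ₑ-reflexive : ∀ {a b} → a ≡ b → a ⪯ₑ b
    ⪯ₑ-reflexive refl = inj₂ (refl , ⪯-refl)
    ⪯ₑ-trans : ∀ {a b c} → a ⪯ₑ b → b ⪯ₑ c → a ⪯ₑ c
    ⪯ₑ-trans {b = b} (inj₁ (p , _)) (inj₁ (q , b̄≢c̄)) =
      inj₁ (⪯-trans p q , λ ā≡c̄ → b̄≢c̄ (antisym q (subst (_⪯ partX̄ {n} {1} b) ā≡c̄ p)))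
    ⪯ₑ-trans (inj₁ (p , ā≢b̄)) (inj₂ (b̄≡c̄ , _)) =
      inj₁ (subst (_ ⪯_) b̄≡c̄ p , λ ā≡c̄ → ā≢b̄ (trans ā≡c̄ (sym b̄≡c̄)))
    ⪯ₑ-trans (inj₂ (ā≡b̄ , _)) (inj₁ (q , b̄≢c̄)) =
      inj₁ (subst (_⪯ _) (sym ā≡b̄) q , λ ā≡c̄ → b̄≢c̄ (trans (sym ā≡b̄) ā≡c̄))
    ⪯ₑ-trans (inj₂ (ā≡b̄ , p)) (inj₂ (b̄≡c̄ , q)) = inj₂ (trans ā≡b̄ b̄≡c̄ , ⪯-trans p q)
    ⪯ₑ-total : ∀ a b → a ⪯ₑ b ⊎ b ⪯ₑ a
    ⪯ₑ-total a b with ≡-dec ℕ._≟_ (partX̄ {n} {1} a) (partX̄ {n} {1} b)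
    ... | yes ā≡b̄ with ⪯-total (partX {n} {1} a) (partX {n} {1} b)
    ...   | inj₁ p = inj₁ (inj₂ (ā≡b̄ , p))
    ...   | inj₂ q = inj₂ (inj₂ (sym ā≡b̄ , q))
    ⪯ₑ-total a b | no ā≢b̄ with ⪯-total (partX̄ {n} {1} a) (partX̄ {n} {1} b)
    ...   | inj₁ p = inj₁ (inj₁ (p , ā≢b̄))
    ...   | inj₂ q = inj₂ (inj₁ (q , λ b̄≡ā → ā≢b̄ (sym b̄≡ā)))

  cancel-lead-InX : ∀ (h g : Poly (n + 1)) B mg (g≢0 : coeff g mg ≢ 0ℚ) → InSpanX {n} {1} h → InSpanX {n} {1} g →
                    InX B → InX mg → InSpanX {n} {1} (h -P (quotientTerm h g B mg g≢0 *P g))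
  cancel-lead-InX h g B mg g≢0 hX gX B∈X mg∈X m m≢0 with support--P h (quotientTerm h g B mg g≢0 *P g) m m≢0
  ... | inj₁ h≢0  = hX m h≢0
  ... | inj₂ qg≢0 with support-term*P (quotientCoeff h g B mg g≢0) (Vec.zipWith ℕ._∸_ B mg) g m qg≢0
  ...   | b , refl , b≢0 = InX-·m (InX-∸ B∈X mg∈X) (gX b b≢0)

module Projection (n : ℕ) (ord : MonomialOrder (n + 1)) (Z G : List (Poly (n + 1)))
                  (gb : IsGroebnerBasis (elimOrder {n} {1} ord) G Z) where
  open MonomialOrder ord
  open LastVariable n
  open Elimination n ord

  G∩X : Pred (Poly n) 0ℓ
  G∩X = GInX {n} {1} G

  G⊆⟨Z⟩ : ∀ g → g ∈ G → InIdeal ⟦ Z ⟧ g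
  G⊆⟨Z⟩ g g∈G = All.lookup (proj₁ gb) g∈G

  private module ev = IsRingHom (evalAt-isRingHom 1ℚ)

  evalAt-≋0P : ∀ {h} → h ≋ 0P → InIdeal G∩X (evalAt 1ℚ h)
  evalAt-≋0P h≋0 = InIdeal-resp (ev.resp h≋0) InIdeal-0

  -- The divisor g of the leading term lies in ℚ[X]: its leading monomial divides an
  -- X-monomial, and under ⪯ₑ every monomial involving t lies above all X-monomials.
  reduce : ∀ B → Acc _≺_ B → ∀ h → InIdeal ⟦ Z ⟧ h → InSpanX {n} {1} h → IsLM _⪯ₑ_ h B →
           InIdeal G∩X (evalAt 1ℚ h)
  reduce B (acc smaller) h hI hX lead@(B∈h , h⪯ₑB) with proj₂ gb h B hI lead
  ... | g , mg , g∈G , (mg∈g , g⪯ₑmg) , mg∣B =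
    InIdeal-resp split (InIdeal-+ (evalAt 1ℚ h′) (evalAt 1ℚ (q *P g)) remainder multiple)
    where
    B∈X : InX B
    B∈X = hX B B∈h
    mg∈X : InX mg
    mg∈X = ∣m-drop-oneM n mg B mg∣B B∈X
    gX : InSpanX {n} {1} g
    gX m m≢0 = ⪯ₑ-InX mg∈X (g⪯ₑmg m m≢0)
    q : Poly (n + 1)
    q = quotientTerm h g B mg mg∈g
    h′ : Poly (n + 1)
    h′ = h -P (q *P g)
    h′I : InIdeal ⟦ Z ⟧ h′
    h′I = InIdeal-+ h (-P (q *P g)) hI (InIdeal-scale (ℚ.- 1ℚ) (q *P g) (InIdeal-* q g (G⊆⟨Z⟩ g g∈G)))
    h′⪯B : ∀ m → coeff h′ m ≢ 0ℚ → m ⪯ B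
    h′⪯B = cancel-lead-below ord h g B mg mg∈g mg∣B
      (λ m m≢0 → ⪯ₑ⇒⪯ (hX m m≢0) B∈X (h⪯ₑB m m≢0)) (λ m m≢0 → ⪯ₑ⇒⪯ (gX m m≢0) mg∈X (g⪯ₑmg m m≢0))
    remainder : InIdeal G∩X (evalAt 1ℚ h′)
    remainder with lead-or-zero ⪯ₑ-isTotalPreorder h′
    ... | inj₁ h′≋0 = evalAt-≋0P h′≋0
    ... | inj₂ (B′ , lead′@(B′∈h′ , _)) = reduce B′ (smaller (h′⪯B B′ B′∈h′ , B′≢B)) h′ h′I
                                                  (cancel-lead-InX h g B mg mg∈g hX gX B∈X mg∈X) lead′
      where
      B′≢B : B′ ≢ B
      B′≢B B′≡B = B′∈h′ (trans (cong (coeff h′) B′≡B) (coeff-cancel-lead h g B mg mg∈g mg∣B))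
    multiple : InIdeal G∩X (evalAt 1ℚ (q *P g))
    multiple = InIdeal-resp (ev.*-homo q g)
      (InIdeal-* (evalAt 1ℚ q) (evalAt 1ℚ g) (InIdeal-gen {S = G∩X} {z = evalAt 1ℚ g} (g , g∈G , ≋⇒≈ (embed-evalAt 1ℚ g gX))))
    split : evalAt 1ℚ h ≋ evalAt 1ℚ h′ +P evalAt 1ℚ (q *P g)
    split = ≋-trans (ev.resp (-P-+P-cancel h (q *P g))) (ev.+-homo h′ (q *P g))

  elimination : ∀ h → InIdeal ⟦ Z ⟧ h → InSpanX {n} {1} h → InIdeal G∩X (evalAt 1ℚ h)
  elimination h hI hX with lead-or-zero ⪯ₑ-isTotalPreorder h
  ... | inj₁ h≋0        = evalAt-≋0P h≋0
  ... | inj₂ (B , lead) = reduce B (wellOrder B) h hI hX lead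

  Reduced : Poly (n + 1) → Set
  Reduced r = ∀ g mg m → g ∈ G → IsLM _⪯ₑ_ g mg → coeff r m ≢ 0ℚ → ¬ (mg ∣m m)

  module _ {R : List (Poly (n + 1))} (reduced : ∀ r → r ∈ R → Reduced r) where

    outside-X : ∀ f h c → embed 1 f ≋ h +P c → ∀ a → ¬ InX a → coeff h a ℚ.+ coeff c a ≡ 0ℚ
    outside-X f h c (mk≋ e) a a∉X = trans (sym (coeff-+P h c a))
      (trans (sym (e a)) (decidable-stable (coeff (embed 1 f) a ℚ.≟ 0ℚ) (λ a∈f → a∉X (embed-inSpanX f a a∈f))))

    -- A t-monomial of c would also occur in h, hence so would the leading monomial M of h;
    -- M is then a t-monomial of c, hence of some r ∈ R, and divisible by a leading monomial of G.
    cone-part-InX : ∀ f h c → InIdeal ⟦ Z ⟧ h → InCone R c → embed 1 f ≋ h +P c → InSpanX {n} {1} c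
    cone-part-InX f h c hI cR f≋ a a∈c = decidable-stable (≡-dec ℕ._≟_ (Vec.drop n a) oneM) ¬¬InX
      where
      ¬¬InX : ¬ ¬ InX a
      ¬¬InX a∉X with lead-exists ⪯ₑ-isTotalPreorder h a (nonzero-summandˡ _ _ (outside-X f h c f≋ a a∉X) a∈c)
      ... | M , lead@(M∈h , _) , a⪯ₑM
          with InCone-support c M cR (nonzero-summandʳ _ _ (outside-X f h c f≋ M (λ M∈X → a∉X (⪯ₑ-InX M∈X a⪯ₑM))) M∈h)
             | proj₂ gb h M hI lead
      ...   | r , r∈R , M∈r | g , mg , g∈G , lmg , mg∣M = reduced r r∈R g mg M g∈G lmg M∈r mg∣M

    ideal-part-InX : ∀ f h c → InSpanX {n} {1} c → embed 1 f ≋ h +P c → InSpanX {n} {1} h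
    ideal-part-InX f h c cX f≋ a a∈h = decidable-stable (≡-dec ℕ._≟_ (Vec.drop n a) oneM)
      λ a∉X → a∉X (cX a (nonzero-summandʳ _ _ (outside-X f h c f≋ a a∉X) a∈h))

    project-⊇ : ∀ {Q} → IsProjX {n} {1} R Q → ∀ f → InAlgCone ⟦ Z ⟧ R (embed 1 f) → InAlgCone G∩X Q f
    project-⊇ {Q} proj f (h , c , hI , cR , f≈) = evalAt 1ℚ h , evalAt 1ℚ c , elimination h hI hX , cQ , ≋⇒≈ f≋
      where
      f≋ₑ : embed 1 f ≋ h +P c
      f≋ₑ = mk≋ f≈
      cX : InSpanX {n} {1} c
      cX = cone-part-InX f h c hI cR f≋ₑ
      hX : InSpanX {n} {1} h
      hX = ideal-part-InX f h c cX f≋ₑ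
      embedded-Q : ∀ y → y ∈ map (embed 1) Q → InCone Q (evalAt 1ℚ y)
      embedded-Q y y∈ with ∈-map⁻ (embed 1) y∈
      ... | q , q∈Q , refl = InCone-resp (≡⇒≋ (evalAt-embed 1ℚ q)) (InCone-gen q∈Q)
      cQ : InCone Q (evalAt 1ℚ c)
      cQ = InCone-least (IsConvexCone-preimage (evalAt-isLinear 1ℚ) InCone-isConvexCone) embedded-Q c
                        (proj₂ (proj c) (cR , cX))
      f≋ : f ≋ evalAt 1ℚ h +P evalAt 1ℚ c
      f≋ = ≋-trans (≡⇒≋ (sym (evalAt-embed 1ℚ f))) (≋-trans (ev.resp f≋ₑ) (ev.+-homo h c))

module Forward (n : ℕ) (s : ℚ) (Z P : List (Poly (n + 1))) (Zs Ps : List (Poly n))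
               (Z↦ : ∀ x → x ∈ Z → InIdeal ⟦ Zs ⟧ (LastVariable.evalAt n s x))
               (P↦ : ∀ x → x ∈ P → InAlgCone ⟦ Zs ⟧ Ps (LastVariable.evalAt n s x)) where
  open LastVariable n
  private
    module ev = IsRingHom (evalAt-isRingHom s)
    module evₗ = IsLinear (evalAt-isLinear s)

  ⟨Z⟩↦ : ∀ f → InIdeal ⟦ Z ⟧ f → InIdeal ⟦ Zs ⟧ (evalAt s f)
  ⟨Z⟩↦ = InIdeal-least (IsIdeal-preimage (evalAt-isRingHom s) InIdeal-isIdeal) Z↦

  project-⊆ : ∀ {G R Q} → (∀ g → g ∈ G → InIdeal ⟦ Z ⟧ g) → Pointwise (λ p r → InIdeal ⟦ G ⟧ (p -P r)) P R →
              IsProjX {n} {1} R Q → ∀ f → InAlgCone (GInX {n} {1} G) Q f → InAlgCone ⟦ Zs ⟧ Ps f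
  project-⊆ {G} {R} {Q} G⊆⟨Z⟩ P-R proj = InAlgCone-least InAlgCone-isConvexCone G∩X↦ Q↦
    where
    ⟨G⟩↦ : ∀ f → InIdeal ⟦ G ⟧ f → InIdeal ⟦ Zs ⟧ (evalAt s f)
    ⟨G⟩↦ = InIdeal-least (IsIdeal-preimage (evalAt-isRingHom s) InIdeal-isIdeal) (λ g g∈G → ⟨Z⟩↦ g (G⊆⟨Z⟩ g g∈G))
    G∩X⊆⟨Zs⟩ : ∀ h → GInX {n} {1} G h → InIdeal ⟦ Zs ⟧ h
    G∩X⊆⟨Zs⟩ h (g , g∈G , h≈g) =
      InIdeal-resp (≋-trans (≡⇒≋ (sym (evalAt-embed s h))) (ev.resp (mk≋ {p = embed 1 h} {g} h≈g))) (⟨Z⟩↦ g (G⊆⟨Z⟩ g g∈G))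
    G∩X↦ : ∀ f → InIdeal (GInX {n} {1} G) f → InAlgCone ⟦ Zs ⟧ Ps f
    G∩X↦ f fI = InIdeal⇒InAlgCone f (InIdeal-least InIdeal-isIdeal G∩X⊆⟨Zs⟩ f fI)
    R↦ : ∀ r → r ∈ R → InAlgCone ⟦ Zs ⟧ Ps (evalAt s r)
    R↦ r r∈R with Pointwise-∈ʳ P-R r∈R
    ... | p , p∈P , p-r∈⟨G⟩ = InAlgCone-resp r-as-sum
      (InAlgCone-+ (evalAt s p) (scale (ℚ.- 1ℚ) (evalAt s (p -P r))) (P↦ p p∈P)
        (InIdeal⇒InAlgCone (scale (ℚ.- 1ℚ) (evalAt s (p -P r)))
          (InIdeal-scale (ℚ.- 1ℚ) (evalAt s (p -P r)) (⟨G⟩↦ (p -P r) p-r∈⟨G⟩))))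
      where
      r-as-sum : evalAt s r ≋ evalAt s p +P scale (ℚ.- 1ℚ) (evalAt s (p -P r))
      r-as-sum = ≋-trans (ev.resp (-P--P-cancel p r))
        (≋-trans (ev.+-homo p (scale (ℚ.- 1ℚ) (p -P r))) (+P-cong ≋-refl (evₗ.scale-homo (ℚ.- 1ℚ) (p -P r))))
    Q↦ : ∀ q → q ∈ Q → InAlgCone ⟦ Zs ⟧ Ps q
    Q↦ q q∈Q = InAlgCone-resp (≡⇒≋ (sym (evalAt-embed s q)))
      (InCone-least (IsConvexCone-preimage (evalAt-isLinear s) InAlgCone-isConvexCone) R↦ (embed 1 q)
        (proj₁ (proj₁ (proj (embed 1 q)) (InCone-gen (∈-map⁺ (embed 1) q∈Q)))))

module Lifting (n : ℕ) (Z₁ P₁ Z₂ P₂ : List (Poly n)) {G R : List (Poly (n + 1))}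
               (G⊆⟨Z⟩ : ∀ g → g ∈ G → InIdeal ⟦ interZ Z₁ Z₂ ⟧ g)
               (P-R : Pointwise (λ p r → InIdeal ⟦ G ⟧ (p -P r)) (interP P₁ P₂) R) where
  open LastVariable n

  interP⊆ : ∀ p → p ∈ interP P₁ P₂ → InAlgCone ⟦ interZ Z₁ Z₂ ⟧ R p
  interP⊆ p p∈ with Pointwise-∈ˡ P-R p∈
  ... | r , r∈R , p-r∈⟨G⟩ =
    p -P r , r , InIdeal-least InIdeal-isIdeal G⊆⟨Z⟩ (p -P r) p-r∈⟨G⟩ , InCone-gen r∈R , ≋⇒≈ (-P-+P-cancel p r)

  *embed-⊆ : ∀ w (Zs Ps : List (Poly n)) →
             (∀ z → z ∈ Zs → w *P embed 1 z ∈ interZ Z₁ Z₂) → (∀ p → p ∈ Ps → w *P embed 1 p ∈ interP P₁ P₂) →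
             ∀ x → InAlgCone ⟦ Zs ⟧ Ps x → InAlgCone ⟦ interZ Z₁ Z₂ ⟧ R (w *P embed 1 x)
  *embed-⊆ w Zs Ps Zs↦ Ps↦ = InAlgCone-least cone ideal-part (λ p p∈ → interP⊆ _ (Ps↦ p p∈))
    where
    cone : IsConvexCone (λ x → InAlgCone ⟦ interZ Z₁ Z₂ ⟧ R (w *P embed 1 x))
    cone = IsConvexCone-preimage (∘-isLinear (*P-isLinear w) embed-isLinear) InAlgCone-isConvexCone
    ideal-part : ∀ x → InIdeal ⟦ Zs ⟧ x → InAlgCone ⟦ interZ Z₁ Z₂ ⟧ R (w *P embed 1 x)
    ideal-part x xI = InIdeal⇒InAlgCone (w *P embed 1 x)
      (InIdeal-least (IsIdeal-preimage embed-isRingHom (IsIdeal-colon w InIdeal-isIdeal))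
                     (λ z z∈ → InIdeal-gen {z = w *P embed 1 z} (Zs↦ z z∈)) x xI)

  embed-∈-interAlgCone : ∀ f → InAlgCone ⟦ Z₁ ⟧ P₁ f → InAlgCone ⟦ Z₂ ⟧ P₂ f →
                         InAlgCone ⟦ interZ Z₁ Z₂ ⟧ R (embed 1 f)
  embed-∈-interAlgCone f f∈₁ f∈₂ = InAlgCone-resp (complement-split tVar (embed 1 f))
    (InAlgCone-+ (tVar *P embed 1 f) ((1P -P tVar) *P embed 1 f)
      (*embed-⊆ tVar Z₁ P₁ (λ _ → t*embed∈interZ Z₁ Z₂) (λ _ → t*embed∈interZ P₁ P₂) f f∈₁)
      (*embed-⊆ (1P -P tVar) Z₂ P₂ (λ _ → [1-t]*embed∈interZ Z₁ Z₂) (λ _ → [1-t]*embed∈interZ P₁ P₂) f f∈₂))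

theorem3p11 : (n : ℕ) (Z₁ P₁ Z₂ P₂ : List (Poly n))
    → (ord : MonomialOrder (n + 1))
    → (G : List (Poly (n + 1)))
    → IsGroebnerBasis (elimOrder {n} {1} ord) G (interZ Z₁ Z₂)
    → (R : List (Poly (n + 1)))
    → Pointwise (IsNormalForm (elimOrder {n} {1} ord) G) (interP P₁ P₂) R
    → (Q : List (Poly n))
    → IsProjX {n} {1} R Q
    → (f : Poly n)
    → InAlgCone (GInX {n} {1} G) Q f ⇔ (InAlgCone ⟦ Z₁ ⟧ P₁ f × InAlgCone ⟦ Z₂ ⟧ P₂ f)
theorem3p11 n Z₁ P₁ Z₂ P₂ ord G gb R nf Q proj f = mk⇔
  (λ f∈ → At1.project-⊆ G⊆⟨Z⟩ P-R proj f f∈ , At0.project-⊆ G⊆⟨Z⟩ P-R proj f f∈)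
  (λ (f∈₁ , f∈₂) → project-⊇ reduced proj f (embed-∈-interAlgCone f f∈₁ f∈₂))
  where
  open LastVariable n
  open Projection n ord (interZ Z₁ Z₂) G gb using (G⊆⟨Z⟩; Reduced; project-⊇)
  P-R : Pointwise (λ p r → InIdeal ⟦ G ⟧ (p -P r)) (interP P₁ P₂) R
  P-R = PW.map proj₁ nf
  reduced : ∀ r → r ∈ R → Reduced r
  reduced r r∈R = proj₂ (proj₂ (proj₂ (Pointwise-∈ʳ nf r∈R)))
  open Lifting n Z₁ P₁ Z₂ P₂ G⊆⟨Z⟩ P-R using (embed-∈-interAlgCone)
  module At1 = Forward n 1ℚ (interZ Z₁ Z₂) (interP P₁ P₂) Z₁ P₁
    (evalAt-1-interZ Z₁ Z₂ (InIdeal-isConvexCone {S = ⟦ Z₁ ⟧}) (λ _ → InIdeal-gen))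
    (evalAt-1-interZ P₁ P₂ (InAlgCone-isConvexCone {S = ⟦ Z₁ ⟧} {P₁}) (λ p p∈ → InCone⇒InAlgCone p (InCone-gen p∈)))
  module At0 = Forward n 0ℚ (interZ Z₁ Z₂) (interP P₁ P₂) Z₂ P₂
    (evalAt-0-interZ Z₁ Z₂ (InIdeal-isConvexCone {S = ⟦ Z₂ ⟧}) (λ _ → InIdeal-gen))
    (evalAt-0-interZ P₁ P₂ (InAlgCone-isConvexCone {S = ⟦ Z₂ ⟧} {P₂}) (λ p p∈ → InCone⇒InAlgCone p (InCone-gen p∈)))
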